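{- Let $k,t\in\mathbb{N}$ with $k\geq 2$. For all sufficiently large $n\in\mathbb{N}$, \[\mathrm{ex}_k^{c\ell+}(n,M_t^k)=\sum_{r=1}^{t-1}\sum_{i=1}^{r}\binom{t-1}{r}\binom{n-t+1}{k-i}=\sum_{r=1}^{t-1}\binom{t-1}{r}\binom{n}{k-1}+o(n^{k-1}).\]
   Context: $M^k_t$ is the $k$-uniform matching consisting of $t$ pairwise disjoint edges. Given a $k$-uniform hypergraph $G$, a set $T\subseteq V(G)$ is a clique in $G$ if $T$ is a singleton, or $T$ is a subset of some edge of $G$, or every $k$-element subset of $T$ is an edge of $G$. $\mathrm{ex}_k^{c\ell+}(n,H)$ is the maximum number of cliques of order at least $k$ in an $n$-vertex $k$-uniform hypergraph containing no copy of $H$. -}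

module Defs where

open import Data.Nat using (ℕ; zero; suc; _+_; _*_; _∸_; _≤_; _<_)
open import Data.Nat.Combinatorics using (_C_)
open import Data.Nat.Properties using (_<?_)
open import Data.Fin using (Fin; quotient)
open import Data.Fin.Subset using (Subset; _∈_; _⊆_; ∣_∣)
open import Data.List using (List; length)
open import Data.List.Relation.Unary.Unique.Propositional using (Unique)
open import Data.List.Membership.Propositional using () renaming (_∈_ to _∈ˡ_)
open import Data.Product using (Σ; _×_; _,_)
open import Data.Sum using (_⊎_)
open import Relation.Binary.PropositionalEquality using (_≡_)
open import Relation.Nullary using (¬_; yes; no)
open import Function.Bundles using (_⇔_)

record Hypergraph (n : ℕ) : Set₁ where
  field
    Edge : Subset n → Set
open Hypergraph public

Uniform : ∀ {n} → ℕ → Hypergraph n → Set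
Uniform k G = ∀ e → Edge G e → ∣ e ∣ ≡ k

Contains : ∀ {m n} → Hypergraph n → Hypergraph m → Set
Contains {m} {n} G H =
  Σ (Fin m → Fin n) λ f →
    (∀ x y → f x ≡ f y → x ≡ y) ×
    (∀ e → Edge H e →
      Σ (Subset n) λ e' → Edge G e' ×
        (∀ y → (y ∈ e') ⇔ (Σ (Fin m) λ x → (x ∈ e) × (f x ≡ y))))

-- The k-uniform matching M^k_t: vertex set Fin (t * k), split into t blocks
-- {ik, …, ik+k-1}; the edges are exactly these t blocks (pairwise disjoint, size k).
Matching : (t k : ℕ) → Hypergraph (t * k)
Matching t k = record
  { Edge = λ e → Σ (Fin t) λ i → ∀ v → (v ∈ e) ⇔ (quotient {t} k v ≡ i) }

IsClique : ∀ {n} → ℕ → Hypergraph n → Subset n → Set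
IsClique k G T =
  (∣ T ∣ ≡ 1) ⊎
  (Σ (Subset _) λ e → Edge G e × (T ⊆ e)) ⊎
  (∀ S → S ⊆ T → ∣ S ∣ ≡ k → Edge G S)

IsBigClique : ∀ {n} → ℕ → Hypergraph n → Subset n → Set
IsBigClique k G T = (k ≤ ∣ T ∣) × IsClique k G T

-- "Exactly N subsets of Fin n satisfy P": a duplicate-free list enumerating
-- exactly the subsets satisfying P, of length N.
CountIs : ∀ {n} → (Subset n → Set) → ℕ → Set
CountIs {n} P N =
  Σ (List (Subset n)) λ L → Unique L × (∀ T → (T ∈ˡ L) ⇔ P T) × (length L ≡ N)

Free : ∀ {n m} → ℕ → Hypergraph m → Hypergraph n → Set
Free k H G = Uniform k G × ¬ Contains G H

ExCliquePlusIs : (k n : ℕ) → ∀ {m} → Hypergraph m → ℕ → Set₁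
ExCliquePlusIs k n H N =
  (Σ (Hypergraph n) λ G → Free k H G × CountIs (IsBigClique k G) N) ×
  (∀ (G : Hypergraph n) → Free k H G → ∀ M → CountIs (IsBigClique k G) M → M ≤ N)

-- Σ_{r=a}^{b} f r  (empty when b < a).
sumFromTo : ℕ → ℕ → (ℕ → ℕ) → ℕ
sumFromTo a zero    f with a Data.Nat.≤? 0
... | yes _ = f 0
... | no  _ = 0
sumFromTo a (suc b) f with a Data.Nat.≤? suc b
... | yes _ = sumFromTo a b f + f (suc b)
... | no  _ = 0

-- Binomial coefficient C(m, j) for an integer lower index j = k - i,
-- which is 0 when k < i (negative lower index).
binomDiff : ℕ → ℕ → ℕ → ℕ
binomDiff m k i with k <? i
... | yes _ = 0
... | no  _ = m C (k ∸ i)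

exValue : (k t n : ℕ) → ℕ
exValue k t n =
  sumFromTo 1 (t ∸ 1) λ r →
    sumFromTo 1 r λ i → ((t ∸ 1) C r) * binomDiff ((n + 1) ∸ t) k i

{-# OPTIONS --safe #-}
module Submission where

-- Lower bound: take an s-set A, s = t − 1, and all k-sets meeting A.  Every edge meets A, so there
-- is no M^k_t, and the cliques of order ≥ k are the sets T with ∣ T ∣ ≥ k and ∣ T ─ A ∣ < k;
-- counting them by ∣ T ∩ A ∣ and ∣ T ─ A ∣ gives exValue.
--
-- Upper bound: at most (n + 1)^(k − 2) edges contain two given vertices, so a vertex of degree
-- more than (kt + t)(n + 1)^(k − 2) ("heavy") lies on an edge avoiding any kt + t vertices, and
-- heavy vertices extend greedily to disjoint edges.  Hence there are at most s heavy vertices, and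
-- if there are exactly s of them they meet every edge, so the cliques are counted as for A.  With
-- fewer heavy vertices, let W be the union of a maximal matching (∣ W ∣ ≤ ks).  A clique has at
-- most k − 2 vertices outside W, or is a (k − 1)-set outside W plus a light vertex of W, or is
-- counted by its profile with respect to the heavy set; the first two kinds are O(n^(k − 2)) many,
-- while one heavy vertex fewer costs C(n − s, k − 1) cliques, which wins for large n.

open import Defs
open import Data.Nat using (ℕ; _≤_)
open import Data.Product using (Σ)

open import Data.Bool using (Bool; true; false; _∧_; _∨_; not; if_then_else_) renaming (_≟_ to _≟B_)
open import Data.Bool.Properties using (T-≡; ¬-not; ∧-zeroʳ; ∧-identityʳ; ∨-zeroʳ; ∨-identityʳ)
open import Data.Empty using (⊥-elim) renaming (⊥ to Empty)
open import Data.Fin using (Fin; zero; suc; quotient; remQuot; combine)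
import Data.Fin as Fin
open import Data.Fin.Properties using (any?; pigeonhole; remQuot-combine; combine-remQuot)
import Data.Fin.Properties as Finₚ
open import Data.Fin.Subset using (Subset; ∣_∣; _∩_; _∪_; _─_; _-_; ∁; ⁅_⁆; ⊥; ⊤; ⋃; _∈_; _⊆_)
open import Data.Fin.Subset.Properties
  using (anySubset?; ∣⊤∣≡n; ∣⊥∣≡0; ∣∁p∣≡n∸∣p∣; x∈⁅x⁆; x∈⁅y⁆⇒x≡y; p⊆q⇒∣p∣≤∣q∣; ∪-identityʳ; p─⊥≡p)
open import Data.List using (List; []; _∷_; length; map; _++_)
import Data.List as List
open import Data.List.Properties using (length-++; length-map)
open import Data.List.Membership.Propositional using () renaming (_∈_ to _∈ˡ_)
open import Data.List.Membership.Propositional.Properties using (∈-map⁻; ∈-map⁺; ∈-++⁻; ∈-++⁺ˡ; ∈-++⁺ʳ)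
open import Data.List.Relation.Unary.Any using (here; there)
import Data.List.Relation.Unary.All as All
open import Data.List.Relation.Unary.AllPairs using ([]; _∷_)
open import Data.List.Relation.Unary.Unique.Propositional using (Unique)
import Data.List.Relation.Unary.Unique.Propositional.Properties as Unique
open import Data.Nat hiding (∣_-_∣; _!)
open import Data.Nat.Combinatorics using (_C_; nCk+nC[k+1]≡[n+1]C[k+1]; k>n⇒nCk≡0)
open import Data.Nat.DivMod using (_/_; _%_; m/n*n≤m; m*n/n≡m; /-monoˡ-≤; m≡m%n+[m/n]*n; m%n<n)
open import Data.Nat.Properties
open import Data.Nat.Tactic.RingSolver using (solve-∀)
open import Algebra.Properties.CommutativeSemigroup +-commutativeSemigroup using (interchange; xy∙z≈xz∙y)
open import Data.Product using (_×_; _,_; proj₁; proj₂; uncurry)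
open import Data.Sum using (_⊎_; inj₁; inj₂)
open import Data.Unit using (tt) renaming (⊤ to Unit)
open import Data.Vec using ([]; _∷_; lookup; tabulate)
open import Data.Vec.Properties
  using (≡-dec; ∷-injectiveʳ; []=⇒lookup; lookup⇒[]=; lookup-zipWith; lookup-replicate; lookup∘tabulate)
open import Function using (_∘_; id)
open import Function.Bundles using (Equivalence; mk⇔; _⇔_)
open import Relation.Binary.Definitions using (DecidableEquality; Tri; tri<; tri≈; tri>)
open import Relation.Binary.PropositionalEquality
open import Relation.Nullary using (Dec; yes; no; ¬_; does)
open import Relation.Nullary.Decidable using (dec-true)

⟦_⟧ : Bool → ℕ
⟦ true ⟧ = 1
⟦ false ⟧ = 0

⟦⟧≤1 : ∀ b → ⟦ b ⟧ ≤ 1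
⟦⟧≤1 true = ≤-refl
⟦⟧≤1 false = z≤n

false≢true : false ≢ true
false≢true ()

∧-elim : ∀ {a b} → (a ∧ b) ≡ true → a ≡ true × b ≡ true
∧-elim {true} {true} _ = refl , refl

∧-intro : ∀ {a b} → a ≡ true → b ≡ true → (a ∧ b) ≡ true
∧-intro refl refl = refl

∨-elim : ∀ {a b} → (a ∨ b) ≡ true → a ≡ true ⊎ b ≡ true
∨-elim {true} _ = inj₁ refl
∨-elim {false} b≡true = inj₂ b≡true

∨-introˡ : ∀ {a} b → a ≡ true → (a ∨ b) ≡ true
∨-introˡ b refl = refl

∨-introʳ : ∀ a {b} → b ≡ true → (a ∨ b) ≡ true
∨-introʳ a refl = ∨-zeroʳ a

not≡true⇒≡false : ∀ {b} → not b ≡ true → b ≡ false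
not≡true⇒≡false {false} _ = refl

does≡true⇒ : ∀ {P : Set} (P? : Dec P) → does P? ≡ true → P
does≡true⇒ (yes p) _ = p

≡ᵇ-true : ∀ {m n} → m ≡ n → (m ≡ᵇ n) ≡ true
≡ᵇ-true {m} {n} m≡n = Equivalence.to T-≡ (≡⇒≡ᵇ m n m≡n)

≡ᵇ-false : ∀ {m n} → m ≢ n → (m ≡ᵇ n) ≡ false
≡ᵇ-false {m} {n} m≢n = ¬-not (m≢n ∘ ≡ᵇ⇒≡ m n ∘ Equivalence.from T-≡)

<ᵇ-true : ∀ {m n} → m < n → (m <ᵇ n) ≡ true
<ᵇ-true m<n = Equivalence.to T-≡ (<⇒<ᵇ m<n)

≤ᵇ-true : ∀ {m n} → m ≤ n → (m ≤ᵇ n) ≡ true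
≤ᵇ-true m≤n = Equivalence.to T-≡ (≤⇒≤ᵇ m≤n)

≤ᵇ-false : ∀ {m n} → m ≰ n → (m ≤ᵇ n) ≡ false
≤ᵇ-false {m} {n} m≰n = ¬-not (m≰n ∘ ≤ᵇ⇒≤ m n ∘ Equivalence.from T-≡)

-- Sums over the subsets of Fin n

sumSubsets : ∀ n → (Subset n → ℕ) → ℕ
sumSubsets zero f = f []
sumSubsets (suc n) f = sumSubsets n (f ∘ (false ∷_)) + sumSubsets n (f ∘ (true ∷_))

sumSubsets-cong : ∀ n {f g : Subset n → ℕ} → (∀ T → f T ≡ g T) → sumSubsets n f ≡ sumSubsets n g
sumSubsets-cong zero f≡g = f≡g []
sumSubsets-cong (suc n) f≡g = cong₂ _+_ (sumSubsets-cong n (f≡g ∘ _)) (sumSubsets-cong n (f≡g ∘ _))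

sumSubsets-mono-≤ : ∀ n {f g : Subset n → ℕ} → (∀ T → f T ≤ g T) → sumSubsets n f ≤ sumSubsets n g
sumSubsets-mono-≤ zero f≤g = f≤g []
sumSubsets-mono-≤ (suc n) f≤g = +-mono-≤ (sumSubsets-mono-≤ n (f≤g ∘ _)) (sumSubsets-mono-≤ n (f≤g ∘ _))

sumSubsets-+ : ∀ n (f g : Subset n → ℕ) →
  sumSubsets n (λ T → f T + g T) ≡ sumSubsets n f + sumSubsets n g
sumSubsets-+ zero f g = refl
sumSubsets-+ (suc n) f g =
  trans (cong₂ _+_ (sumSubsets-+ n _ _) (sumSubsets-+ n _ _)) (interchange f₀ g₀ f₁ g₁)
  where
  f₀ = sumSubsets n (f ∘ (false ∷_))
  g₀ = sumSubsets n (g ∘ (false ∷_))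
  f₁ = sumSubsets n (f ∘ (true ∷_))
  g₁ = sumSubsets n (g ∘ (true ∷_))

sumSubsets-* : ∀ n c (f : Subset n → ℕ) → sumSubsets n (λ T → c * f T) ≡ c * sumSubsets n f
sumSubsets-* zero c f = refl
sumSubsets-* (suc n) c f = trans (cong₂ _+_ (sumSubsets-* n c _) (sumSubsets-* n c _)) (sym (*-distribˡ-+ c _ _))

sumSubsets-0 : ∀ n → sumSubsets n (λ _ → 0) ≡ 0
sumSubsets-0 zero = refl
sumSubsets-0 (suc n) = cong₂ _+_ (sumSubsets-0 n) (sumSubsets-0 n)

sumSizes : ℕ → (ℕ → ℕ) → ℕ
sumSizes n g = sumSubsets n (λ T → g ∣ T ∣)

sumSubsets-profile : ∀ n (B : Subset n) (w : ℕ → ℕ → ℕ) →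
  sumSubsets n (λ T → w ∣ T ∩ B ∣ ∣ T ─ B ∣) ≡ sumSizes ∣ B ∣ (λ r → sumSizes ∣ ∁ B ∣ (w r))
sumSubsets-profile zero [] w = refl
sumSubsets-profile (suc n) (true ∷ B) w =
  cong₂ _+_ (sumSubsets-profile n B w) (sumSubsets-profile n B (w ∘ suc))
sumSubsets-profile (suc n) (false ∷ B) w =
  trans (cong₂ _+_ (sumSubsets-profile n B w) (sumSubsets-profile n B (λ r j → w r (suc j))))
        (sym (sumSubsets-+ ∣ B ∣ _ _))

sumSizes-exactly : ∀ m i → sumSizes m (λ j → ⟦ j ≡ᵇ i ⟧) ≡ m C i
sumSizes-exactly zero zero = refl
sumSizes-exactly zero (suc i) = refl
sumSizes-exactly (suc m) zero =
  trans (cong (sumSizes m (λ j → ⟦ j ≡ᵇ 0 ⟧) +_) (sumSubsets-0 m))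
        (trans (+-identityʳ _) (sumSizes-exactly m 0))
sumSizes-exactly (suc m) (suc i) =
  trans (cong₂ _+_ (sumSizes-exactly m (suc i)) (sumSizes-exactly m i))
        (trans (+-comm (m C suc i) (m C i)) (nCk+nC[k+1]≡[n+1]C[k+1] m i))

sumSizes-shifted-exactly : ∀ m k i → sumSizes m (λ j → ⟦ i + j ≡ᵇ k ⟧) ≡ binomDiff m k i
sumSizes-shifted-exactly m k i with k <? i
... | yes k<i = trans (sumSubsets-cong m (λ T → cong ⟦_⟧ (≡ᵇ-false (>⇒≢ (<-≤-trans k<i (m≤m+n i _))))))
                      (sumSubsets-0 m)
... | no k≮i = trans (sumSubsets-cong m (λ T → cong ⟦_⟧ (shift i k ∣ T ∣ (≮⇒≥ k≮i)))) (sumSizes-exactly m (k ∸ i))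
  where
  shift : ∀ i k j → i ≤ k → (i + j ≡ᵇ k) ≡ (j ≡ᵇ k ∸ i)
  shift zero k j _ = refl
  shift (suc i) (suc k) j (s≤s i≤k) = shift i k j i≤k

sumFrom0-cong : ∀ s {f g : ℕ → ℕ} → (∀ r → f r ≡ g r) → sumFromTo 0 s f ≡ sumFromTo 0 s g
sumFrom0-cong zero f≡g = f≡g 0
sumFrom0-cong (suc s) f≡g = cong₂ _+_ (sumFrom0-cong s f≡g) (f≡g (suc s))

sumFrom0-+ : ∀ s (f g : ℕ → ℕ) → sumFromTo 0 s (λ r → f r + g r) ≡ sumFromTo 0 s f + sumFromTo 0 s g
sumFrom0-+ zero f g = refl
sumFrom0-+ (suc s) f g = trans (cong (_+ (f (suc s) + g (suc s))) (sumFrom0-+ s f g))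
  (interchange (sumFromTo 0 s f) (sumFromTo 0 s g) (f (suc s)) (g (suc s)))

sumFrom0-suc : ∀ s (f : ℕ → ℕ) → sumFromTo 0 (suc s) f ≡ f 0 + sumFromTo 0 s (f ∘ suc)
sumFrom0-suc zero f = refl
sumFrom0-suc (suc s) f = trans (cong (_+ f (suc (suc s))) (sumFrom0-suc s f)) (+-assoc (f 0) _ _)

sumFrom0≡head+sumFrom1 : ∀ s (f : ℕ → ℕ) → sumFromTo 0 s f ≡ f 0 + sumFromTo 1 s f
sumFrom0≡head+sumFrom1 zero f = sym (+-identityʳ _)
sumFrom0≡head+sumFrom1 (suc s) f = trans (cong (_+ f (suc s)) (sumFrom0≡head+sumFrom1 s f)) (+-assoc (f 0) _ _)

sumFrom1-cong : ∀ r {f g : ℕ → ℕ} → (∀ i → f i ≡ g i) → sumFromTo 1 r f ≡ sumFromTo 1 r g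
sumFrom1-cong zero f≡g = refl
sumFrom1-cong (suc r) f≡g = cong₂ _+_ (sumFrom1-cong r f≡g) (f≡g (suc r))

sumFrom1-* : ∀ r c (f : ℕ → ℕ) → sumFromTo 1 r (λ i → c * f i) ≡ c * sumFromTo 1 r f
sumFrom1-* zero c f = sym (*-zeroʳ c)
sumFrom1-* (suc r) c f =
  trans (cong (_+ c * f (suc r)) (sumFrom1-* r c f)) (sym (*-distribˡ-+ c (sumFromTo 1 r f) (f (suc r))))

sumFrom0-binomial-peel : ∀ s (g : ℕ → ℕ) →
  sumFromTo 0 s (λ r → (s C r) * g r) ≡ g 0 + sumFromTo 0 s (λ r → (s C suc r) * g (suc r))
sumFrom0-binomial-peel zero g = cong (g 0 +_) (sym (+-identityʳ _))
sumFrom0-binomial-peel (suc s) g = begin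
    sumFromTo 0 (suc s) (λ r → (suc s C r) * g r)
  ≡⟨ sumFrom0-suc s (λ r → (suc s C r) * g r) ⟩
    (suc s C 0) * g 0 + sumFromTo 0 s (λ r → (suc s C suc r) * g (suc r))
  ≡⟨ cong₂ _+_ (+-identityʳ (g 0)) (sym (+-identityʳ _)) ⟩
    g 0 + (sumFromTo 0 s (λ r → (suc s C suc r) * g (suc r)) + 0)
  ≡⟨ cong (λ c → g 0 + (sumFromTo 0 s (λ r → (suc s C suc r) * g (suc r)) + c * g (suc (suc s))))
          (sym (k>n⇒nCk≡0 {suc s} {suc (suc s)} ≤-refl)) ⟩
    g 0 + sumFromTo 0 (suc s) (λ r → (suc s C suc r) * g (suc r))
  ∎
  where open ≡-Reasoning

sumSizes-binomial : ∀ s (g : ℕ → ℕ) → sumSizes s g ≡ sumFromTo 0 s (λ r → (s C r) * g r)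
sumSizes-binomial zero g = sym (+-identityʳ (g 0))
sumSizes-binomial (suc s) g = begin
    sumSizes s g + sumSizes s (g ∘ suc)
  ≡⟨ cong₂ _+_ (sumSizes-binomial s g) (sumSizes-binomial s (g ∘ suc)) ⟩
    sumFromTo 0 s (λ r → (s C r) * g r) + sumFromTo 0 s (λ r → (s C r) * g (suc r))
  ≡⟨ cong (_+ sumFromTo 0 s (λ r → (s C r) * g (suc r))) (sumFrom0-binomial-peel s g) ⟩
    (g 0 + sumFromTo 0 s (λ r → (s C suc r) * g (suc r))) + sumFromTo 0 s (λ r → (s C r) * g (suc r))
  ≡⟨ +-assoc (g 0) _ _ ⟩
    g 0 + (sumFromTo 0 s (λ r → (s C suc r) * g (suc r)) + sumFromTo 0 s (λ r → (s C r) * g (suc r)))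
  ≡⟨ cong (g 0 +_) (sym (sumFrom0-+ s _ _)) ⟩
    g 0 + sumFromTo 0 s (λ r → (s C suc r) * g (suc r) + (s C r) * g (suc r))
  ≡⟨ cong₂ _+_ (sym (+-identityʳ (g 0))) (sumFrom0-cong s pascal) ⟩
    (suc s C 0) * g 0 + sumFromTo 0 s (λ r → (suc s C suc r) * g (suc r))
  ≡⟨ sym (sumFrom0-suc s (λ r → (suc s C r) * g r)) ⟩
    sumFromTo 0 (suc s) (λ r → (suc s C r) * g r)
  ∎
  where
  open ≡-Reasoning
  pascal : ∀ r → (s C suc r) * g (suc r) + (s C r) * g (suc r) ≡ (suc s C suc r) * g (suc r)
  pascal r = trans (sym (*-distribʳ-+ (g (suc r)) (s C suc r) (s C r)))
                   (cong (_* g (suc r)) (trans (+-comm (s C suc r) (s C r)) (nCk+nC[k+1]≡[n+1]C[k+1] s r)))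

-- coverCount k b m counts the sets T ⊆ B ⊎ M (∣ B ∣ = b, ∣ M ∣ = m) with ∣ T ∣ ≥ k and ∣ T ∩ M ∣ < k,
-- the cliques of order at least k of the hypergraph of all k-sets meeting B.
coverWeight : ℕ → ℕ → ℕ → ℕ
coverWeight k r j = ⟦ (j <ᵇ k) ∧ (k ≤ᵇ r + j) ⟧

coverCount : ℕ → ℕ → ℕ → ℕ
coverCount k b m = sumSizes b (λ r → sumSizes m (coverWeight k r))

coverWeight-intro : ∀ k r j → j < k → k ≤ r + j → coverWeight k r j ≡ 1
coverWeight-intro k r j j<k k≤r+j rewrite <ᵇ-true j<k | ≤ᵇ-true {k} k≤r+j = refl

coverWeight-zero : ∀ k j → coverWeight k 0 j ≡ 0
coverWeight-zero k j with j <ᵇ k in j<ᵇk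
... | true = cong ⟦_⟧ (≤ᵇ-false {k} (<⇒≱ (<ᵇ⇒< j k (Equivalence.from T-≡ j<ᵇk))))
... | false = refl

coverWeight-suc : ∀ k r j → coverWeight k (suc r) j ≡ coverWeight k r j + ⟦ suc r + j ≡ᵇ k ⟧
coverWeight-suc k r j with <-cmp (suc r + j) k
... | tri< r+j<k _ _
  rewrite ≤ᵇ-false {k} {suc r + j} (<⇒≱ r+j<k) | ≤ᵇ-false {k} {r + j} (<⇒≱ (<-trans (n<1+n (r + j)) r+j<k))
        | ≡ᵇ-false (<⇒≢ r+j<k) = sym (+-identityʳ _)
... | tri≈ _ r+j≡k _
  rewrite <ᵇ-true (≤-trans (s≤s (m≤n+m j r)) (≤-reflexive r+j≡k))
        | ≤ᵇ-true {k} {suc r + j} (≤-reflexive (sym r+j≡k)) | ≤ᵇ-false {k} {r + j} (<⇒≱ (≤-reflexive r+j≡k))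
        | ≡ᵇ-true r+j≡k = refl
... | tri> _ _ k<r+j
  rewrite ≤ᵇ-true {k} {suc r + j} (<⇒≤ k<r+j) | ≤ᵇ-true {k} {r + j} (≤-pred k<r+j)
        | ≡ᵇ-false (>⇒≢ k<r+j) = sym (+-identityʳ _)

coverWeight-shift : ∀ k r j → coverWeight k r (suc j) ≤ coverWeight k (suc r) j
coverWeight-shift k r j with suc j <ᵇ k in j<k | k ≤ᵇ r + suc j in k≤r+j
... | true | true = ≤-reflexive (sym (coverWeight-intro k (suc r) j
        (<-trans (n<1+n j) (<ᵇ⇒< (suc j) k (Equivalence.from T-≡ j<k)))
        (≤-trans (≤ᵇ⇒≤ k (r + suc j) (Equivalence.from T-≡ k≤r+j)) (≤-reflexive (+-suc r j)))))
... | true | false = z≤n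
... | false | _ = z≤n

coverWeight-one-vertex : ∀ {k} → 1 ≤ k → ∀ j → ⟦ j ≡ᵇ k ∸ 1 ⟧ ≤ coverWeight k 1 j
coverWeight-one-vertex {k} k≥1 j with j ≡ᵇ k ∸ 1 in eq
... | false = z≤n
... | true = ≤-reflexive (sym (coverWeight-intro k 1 j (≤-reflexive 1+j≡k) (≤-reflexive (sym 1+j≡k))))
  where
  1+j≡k : suc j ≡ k
  1+j≡k = trans (cong suc (≡ᵇ⇒≡ j (k ∸ 1) (Equivalence.from T-≡ eq))) (m+[n∸m]≡n k≥1)

sumSubsets-coverWeight≡coverCount : ∀ n k (X : Subset n) →
  sumSubsets n (λ T → coverWeight k ∣ T ∩ X ∣ ∣ T ─ X ∣) ≡ coverCount k ∣ X ∣ (n ∸ ∣ X ∣)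
sumSubsets-coverWeight≡coverCount n k X =
  trans (sumSubsets-profile n X (coverWeight k)) (cong (coverCount k ∣ X ∣) (∣∁p∣≡n∸∣p∣ X))

sumSizes-coverWeight : ∀ k m r → sumSizes m (coverWeight k r) ≡ sumFromTo 1 r (binomDiff m k)
sumSizes-coverWeight k m zero = trans (sumSubsets-cong m (coverWeight-zero k ∘ ∣_∣)) (sumSubsets-0 m)
sumSizes-coverWeight k m (suc r) = begin
    sumSizes m (coverWeight k (suc r))
  ≡⟨ sumSubsets-cong m (coverWeight-suc k r ∘ ∣_∣) ⟩
    sumSubsets m (λ T → coverWeight k r ∣ T ∣ + ⟦ suc r + ∣ T ∣ ≡ᵇ k ⟧)
  ≡⟨ sumSubsets-+ m (coverWeight k r ∘ ∣_∣) _ ⟩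
    sumSizes m (coverWeight k r) + sumSizes m (λ j → ⟦ suc r + j ≡ᵇ k ⟧)
  ≡⟨ cong₂ _+_ (sumSizes-coverWeight k m r) (sumSizes-shifted-exactly m k (suc r)) ⟩
    sumFromTo 1 (suc r) (binomDiff m k)
  ∎
  where open ≡-Reasoning

exValue≡coverCount : ∀ k s n → exValue k (suc s) n ≡ coverCount k s (n ∸ s)
exValue≡coverCount k s n = begin
    sumFromTo 1 s (λ r → sumFromTo 1 r (λ i → (s C r) * binomDiff (n + 1 ∸ suc s) k i))
  ≡⟨ sumFrom1-cong s (λ r → sumFrom1-* r (s C r) (binomDiff (n + 1 ∸ suc s) k)) ⟩
    sumFromTo 1 s (λ r → (s C r) * sumFromTo 1 r (binomDiff (n + 1 ∸ suc s) k))
  ≡⟨ cong (λ x → sumFromTo 1 s (λ r → (s C r) * sumFromTo 1 r (binomDiff (x ∸ suc s) k))) (+-comm n 1) ⟩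
    sumFromTo 1 s (λ r → (s C r) * sumFromTo 1 r (binomDiff m k))
  ≡⟨ sumFrom1-cong s (λ r → cong ((s C r) *_) (sym (sumSizes-coverWeight k m r))) ⟩
    sumFromTo 1 s term
  ≡⟨ cong (_+ sumFromTo 1 s term) (sym term₀≡0) ⟩
    term 0 + sumFromTo 1 s term
  ≡⟨ sym (sumFrom0≡head+sumFrom1 s term) ⟩
    sumFromTo 0 s term
  ≡⟨ sym (sumSizes-binomial s (λ r → sumSizes m (coverWeight k r))) ⟩
    coverCount k s m
  ∎
  where
  open ≡-Reasoning
  m = n ∸ s
  term : ℕ → ℕ
  term r = (s C r) * sumSizes m (coverWeight k r)
  term₀≡0 : term 0 ≡ 0
  term₀≡0 = trans (cong ((s C 0) *_) (sumSizes-coverWeight k m 0)) (*-zeroʳ (s C 0))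

sumSizes-+-≤ : ∀ b {f g : ℕ → ℕ} {c} → (∀ r → f r ≤ g r) → f 0 + c ≤ g 0 →
  sumSizes b f + c ≤ sumSizes b g
sumSizes-+-≤ zero f≤g head = head
sumSizes-+-≤ (suc b) {f} {g} {c} f≤g head =
  ≤-trans (≤-reflexive (xy∙z≈xz∙y (sumSizes b f) (sumSizes b (f ∘ suc)) c))
          (+-mono-≤ (sumSizes-+-≤ b f≤g head) (sumSubsets-mono-≤ b (f≤g ∘ suc ∘ ∣_∣)))

coverCount-step : ∀ {k} → 1 ≤ k → ∀ b m → coverCount k b (suc m) + m C (k ∸ 1) ≤ coverCount k (suc b) m
coverCount-step {k} k≥1 b m = begin
    coverCount k b (suc m) + m C (k ∸ 1)
  ≡⟨ cong (_+ m C (k ∸ 1)) (sumSubsets-+ b _ (λ T → sumSizes m (coverWeight k ∣ T ∣ ∘ suc))) ⟩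
    (coverCount k b m + sumSizes b (λ r → sumSizes m (coverWeight k r ∘ suc))) + m C (k ∸ 1)
  ≡⟨ +-assoc (coverCount k b m) _ _ ⟩
    coverCount k b m + (sumSizes b (λ r → sumSizes m (coverWeight k r ∘ suc)) + m C (k ∸ 1))
  ≤⟨ +-monoʳ-≤ (coverCount k b m) (sumSizes-+-≤ b shift gain) ⟩
    coverCount k (suc b) m
  ∎
  where
  open ≤-Reasoning
  shift : ∀ r → sumSizes m (coverWeight k r ∘ suc) ≤ sumSizes m (coverWeight k (suc r))
  shift r = sumSubsets-mono-≤ m (coverWeight-shift k r ∘ ∣_∣)
  gain : sumSizes m (coverWeight k 0 ∘ suc) + m C (k ∸ 1) ≤ sumSizes m (coverWeight k 1)
  gain = begin
      sumSizes m (coverWeight k 0 ∘ suc) + m C (k ∸ 1)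
    ≡⟨ cong (_+ m C (k ∸ 1)) (trans (sumSubsets-cong m (coverWeight-zero k ∘ suc ∘ ∣_∣)) (sumSubsets-0 m)) ⟩
      m C (k ∸ 1)
    ≡⟨ sym (sumSizes-exactly m (k ∸ 1)) ⟩
      sumSizes m (λ j → ⟦ j ≡ᵇ k ∸ 1 ⟧)
    ≤⟨ sumSubsets-mono-≤ m (coverWeight-one-vertex k≥1 ∘ ∣_∣) ⟩
      sumSizes m (coverWeight k 1)
    ∎

coverCount-shift : ∀ {k} → 1 ≤ k → ∀ d b m → coverCount k b (m + d) ≤ coverCount k (b + d) m
coverCount-shift k≥1 zero b m rewrite +-identityʳ m | +-identityʳ b = ≤-refl
coverCount-shift k≥1 (suc d) b m rewrite +-suc m d | +-suc b d =
  ≤-trans (≤-trans (m≤m+n _ _) (coverCount-step k≥1 b (m + d))) (coverCount-shift k≥1 d (suc b) m)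

coverCount-gap : ∀ {k b s n} → 1 ≤ k → b < s → s ≤ n →
  coverCount k b (n ∸ b) + (n ∸ s) C (k ∸ 1) ≤ coverCount k s (n ∸ s)
coverCount-gap {k} {b} {s} {n} k≥1 b<s s≤n =
  subst₂ (λ x y → coverCount k b x + M C (k ∸ 1) ≤ coverCount k y M) (sym n∸b≡) s≡
    (≤-trans (+-monoˡ-≤ (M C (k ∸ 1)) (coverCount-shift k≥1 d b (suc M))) (coverCount-step k≥1 (b + d) M))
  where
  d = s ∸ suc b
  M = n ∸ s
  s≡ : suc (b + d) ≡ s
  s≡ = m+[n∸m]≡n b<s
  n∸b≡ : n ∸ b ≡ suc M + d
  n∸b≡ = +-cancelˡ-≡ b (n ∸ b) (suc M + d) (begin
      b + (n ∸ b)      ≡⟨ m+[n∸m]≡n (≤-trans (<⇒≤ b<s) s≤n) ⟩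
      n                ≡⟨ sym (m+[n∸m]≡n s≤n) ⟩
      s + M            ≡⟨ cong (_+ M) (sym s≡) ⟩
      suc (b + d) + M  ≡⟨ rearrange b d M ⟩
      b + (suc M + d)  ∎)
    where
    open ≡-Reasoning
    rearrange : ∀ b d M → suc (b + d) + M ≡ b + (suc M + d)
    rearrange = solve-∀

sumSizes-≤-^ : ∀ n d (g : ℕ → ℕ) → (∀ j → g j ≤ 1) → (∀ j → d < j → g j ≡ 0) → sumSizes n g ≤ suc n ^ d
sumSizes-≤-^ zero d g g≤1 _ = ≤-trans (g≤1 0) (≤-reflexive (sym (^-zeroˡ d)))
sumSizes-≤-^ (suc n) zero g g≤1 g>0≡0 =
  +-mono-≤ (sumSizes-≤-^ n zero g g≤1 g>0≡0)
           (≤-reflexive (trans (sumSubsets-cong n (λ T → g>0≡0 (suc ∣ T ∣) z<s)) (sumSubsets-0 n)))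
sumSizes-≤-^ (suc n) (suc d) g g≤1 g>d≡0 = begin
    sumSizes n g + sumSizes n (g ∘ suc)
  ≤⟨ +-mono-≤ (sumSizes-≤-^ n (suc d) g g≤1 g>d≡0)
              (sumSizes-≤-^ n d (g ∘ suc) (g≤1 ∘ suc) (λ j → g>d≡0 (suc j) ∘ s≤s)) ⟩
    suc n * suc n ^ d + suc n ^ d
  ≡⟨ +-comm (suc n * suc n ^ d) (suc n ^ d) ⟩
    suc (suc n) * suc n ^ d
  ≤⟨ *-monoʳ-≤ (suc (suc n)) (^-monoˡ-≤ d (n≤1+n (suc n))) ⟩
    suc (suc n) ^ suc d
  ∎
  where open ≤-Reasoning

nCk≤[1+n]Ck : ∀ n k → n C k ≤ suc n C k
nCk≤[1+n]Ck n zero = ≤-refl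
nCk≤[1+n]Ck n (suc k) = ≤-trans (m≤n+m (n C suc k) (n C k)) (≤-reflexive (nCk+nC[k+1]≡[n+1]C[k+1] n k))

C-monoˡ-≤ : ∀ k {m n} → m ≤ n → m C k ≤ n C k
C-monoˡ-≤ k = go ∘ ≤⇒≤′
  where
  go : ∀ {m n} → m ≤′ n → m C k ≤ n C k
  go ≤′-refl = ≤-refl
  go (≤′-step m≤′n) = ≤-trans (go m≤′n) (nCk≤[1+n]Ck _ k)

m*nCk≤[m+n]C[1+k] : ∀ m n k → m * (n C k) ≤ (m + n) C suc k
m*nCk≤[m+n]C[1+k] zero n k = z≤n
m*nCk≤[m+n]C[1+k] (suc m) n k =
  ≤-trans (+-mono-≤ (C-monoˡ-≤ k (m≤n+m n m)) (m*nCk≤[m+n]C[1+k] m n k))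
          (≤-reflexive (nCk+nC[k+1]≡[n+1]C[k+1] (m + n) k))

a^k≤[k*a]Ck : ∀ a k → a ^ k ≤ (k * a) C k
a^k≤[k*a]Ck a zero = ≤-refl
a^k≤[k*a]Ck a (suc k) = ≤-trans (*-monoʳ-≤ a (a^k≤[k*a]Ck a k)) (m*nCk≤[m+n]C[1+k] a (k * a) k)

*-^-distrib : ∀ a b d → (a * b) ^ d ≡ a ^ d * b ^ d
*-^-distrib a b zero = refl
*-^-distrib a b (suc d) = trans (cong (a * b *_) (*-^-distrib a b d)) (regroup a b (a ^ d) (b ^ d))
  where
  regroup : ∀ a b x y → a * b * (x * y) ≡ a * x * (b * y)
  regroup = solve-∀

-- With a = ⌊(n − s)/(d + 1)⌋ one has n + 1 ≤ a (2d + s + 2) and a^(d+1) ≤ C(n − s, d + 1),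
-- so the bound holds once a ≥ (K + 1)(2d + s + 2)^d.
polynomial≤binomial : ∀ K d s → Σ ℕ λ n₀ → s ≤ n₀ × (∀ n → n₀ ≤ n → K * suc n ^ d ≤ (n ∸ s) C suc d)
polynomial≤binomial K d s = s + A * c , m≤m+n s (A * c) , bound
  where
  c = suc d
  c′ = c + (c + s)
  A = suc K * c′ ^ d
  bound : ∀ n → s + A * c ≤ n → K * suc n ^ d ≤ (n ∸ s) C c
  bound n n≥ = begin
      K * suc n ^ d
    ≤⟨ *-mono-≤ (n≤1+n K) (^-monoˡ-≤ d 1+n≤a*c′) ⟩
      suc K * (a * c′) ^ d
    ≡⟨ cong (suc K *_) (*-^-distrib a c′ d) ⟩
      suc K * (a ^ d * c′ ^ d)
    ≡⟨ rearrange (suc K) (a ^ d) (c′ ^ d) ⟩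
      A * a ^ d
    ≤⟨ *-monoˡ-≤ (a ^ d) A≤a ⟩
      a ^ c
    ≤⟨ a^k≤[k*a]Ck a c ⟩
      (c * a) C c
    ≤⟨ C-monoˡ-≤ c (≤-trans (≤-reflexive (*-comm c a)) (m/n*n≤m M c)) ⟩
      M C c
    ∎
    where
    open ≤-Reasoning
    rearrange : ∀ x y z → x * (y * z) ≡ x * z * y
    rearrange = solve-∀
    M = n ∸ s
    a = M / c
    s≤n : s ≤ n
    s≤n = ≤-trans (m≤m+n s (A * c)) n≥
    A≤a : A ≤ a
    A≤a = ≤-trans (≤-reflexive (sym (m*n/n≡m A c)))
                  (/-monoˡ-≤ c (+-cancelˡ-≤ s (A * c) M (≤-trans n≥ (≤-reflexive (sym (m+[n∸m]≡n s≤n))))))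
    a≥1 : 1 ≤ a
    a≥1 = ≤-trans (*-mono-≤ {1} {suc K} {1} {c′ ^ d} (s≤s z≤n) (m^n>0 c′ d)) A≤a
    M<c+a*c : M < c + a * c
    M<c+a*c = begin-strict
        M             ≡⟨ m≡m%n+[m/n]*n M c ⟩
        M % c + a * c <⟨ +-monoˡ-< (a * c) (m%n<n M c) ⟩
        c + a * c     ∎
    1+n≤a*c′ : suc n ≤ a * c′
    1+n≤a*c′ = begin
        suc n                ≡⟨ cong suc (trans (sym (m+[n∸m]≡n s≤n)) (+-comm s M)) ⟩
        suc M + s            ≤⟨ +-monoˡ-≤ s M<c+a*c ⟩
        (c + a * c) + s      ≡⟨ regroup c (a * c) s ⟩
        a * c + 1 * (c + s)  ≤⟨ +-monoʳ-≤ (a * c) (*-monoˡ-≤ (c + s) a≥1) ⟩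
        a * c + a * (c + s)  ≡⟨ sym (*-distribˡ-+ a c (c + s)) ⟩
        a * c′               ∎
      where
      regroup : ∀ x y z → (x + y) + z ≡ y + 1 * (x + z)
      regroup = solve-∀

_!_ : ∀ {n} → Subset n → Fin n → Bool
X ! i = lookup X i

_⊆ᵇ_ : ∀ {n} → Subset n → Subset n → Set
X ⊆ᵇ Y = ∀ x → X ! x ≡ true → Y ! x ≡ true

Disjoint : ∀ {n} → Subset n → Subset n → Set
Disjoint X Y = ∀ x → X ! x ≡ true → Y ! x ≡ true → Empty

Meets : ∀ {n} → Subset n → Subset n → Set
Meets X Y = Σ (Fin _) λ x → X ! x ≡ true × Y ! x ≡ true

subset-ext : ∀ {n} (X Y : Subset n) → (∀ i → X ! i ≡ Y ! i) → X ≡ Y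
subset-ext [] [] _ = refl
subset-ext (x ∷ X) (y ∷ Y) X≗Y = cong₂ _∷_ (X≗Y zero) (subset-ext X Y (X≗Y ∘ suc))

∈⇒! : ∀ {n} {x : Fin n} {X} → x ∈ X → X ! x ≡ true
∈⇒! = []=⇒lookup

!⇒∈ : ∀ {n} {x : Fin n} {X} → X ! x ≡ true → x ∈ X
!⇒∈ {x = x} {X} = lookup⇒[]= x X

⊆⇒⊆ᵇ : ∀ {n} {X Y : Subset n} → X ⊆ Y → X ⊆ᵇ Y
⊆⇒⊆ᵇ X⊆Y x x∈X = ∈⇒! (X⊆Y (!⇒∈ x∈X))

⊆ᵇ⇒⊆ : ∀ {n} {X Y : Subset n} → X ⊆ᵇ Y → X ⊆ Y
⊆ᵇ⇒⊆ X⊆Y x∈X = !⇒∈ (X⊆Y _ (∈⇒! x∈X))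

!-∩ : ∀ {n} (X Y : Subset n) i → (X ∩ Y) ! i ≡ (X ! i ∧ Y ! i)
!-∩ X Y i = lookup-zipWith _∧_ i X Y

!-∪ : ∀ {n} (X Y : Subset n) i → (X ∪ Y) ! i ≡ (X ! i ∨ Y ! i)
!-∪ X Y i = lookup-zipWith _∨_ i X Y

!-─ : ∀ {n} (X Y : Subset n) i → (X ─ Y) ! i ≡ (X ! i ∧ not (Y ! i))
!-─ (x ∷ X) (true ∷ Y) zero = sym (∧-zeroʳ x)
!-─ (x ∷ X) (false ∷ Y) zero = sym (∧-identityʳ x)
!-─ (x ∷ X) (y ∷ Y) (suc i) = !-─ X Y i

─⊆ᵇ : ∀ {n} (T X : Subset n) → (T ─ X) ⊆ᵇ T
─⊆ᵇ T X y y∈T─X = proj₁ (∧-elim (trans (sym (!-─ T X y)) y∈T─X))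

─⇒∉ : ∀ {n} (T X : Subset n) y → (T ─ X) ! y ≡ true → X ! y ≡ false
─⇒∉ T X y y∈T─X = not≡true⇒≡false (proj₂ (∧-elim (trans (sym (!-─ T X y)) y∈T─X)))

⊥!≢true : ∀ {n} (x : Fin n) → ⊥ ! x ≢ true
⊥!≢true x x∈⊥ with () ← trans (sym (lookup-replicate x false)) x∈⊥

!-⁅x⁆ : ∀ {n} (x : Fin n) → ⁅ x ⁆ ! x ≡ true
!-⁅x⁆ x = ∈⇒! (x∈⁅x⁆ x)

!-⁅y⁆ : ∀ {n} {x y : Fin n} → x ≢ y → ⁅ y ⁆ ! x ≡ false
!-⁅y⁆ {x = x} {y} x≢y = ¬-not (x≢y ∘ x∈⁅y⁆⇒x≡y y ∘ !⇒∈)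

!-remove : ∀ {n} (X : Subset n) {v i} → i ≢ v → (X - v) ! i ≡ X ! i
!-remove X {v} {i} i≢v = trans (!-─ X ⁅ v ⁆ i) (trans (cong (λ b → X ! i ∧ not b) (!-⁅y⁆ i≢v)) (∧-identityʳ (X ! i)))

!-add : ∀ {n} (Y : Subset n) {x i} → i ≢ x → (Y ∪ ⁅ x ⁆) ! i ≡ Y ! i
!-add Y {x} {i} i≢x = trans (!-∪ Y ⁅ x ⁆ i) (trans (cong (Y ! i ∨_) (!-⁅y⁆ i≢x)) (∨-identityʳ (Y ! i)))

∣T∣≡∣T∩B∣+∣T─B∣ : ∀ {n} (T B : Subset n) → ∣ T ∣ ≡ ∣ T ∩ B ∣ + ∣ T ─ B ∣
∣T∣≡∣T∩B∣+∣T─B∣ [] [] = refl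
∣T∣≡∣T∩B∣+∣T─B∣ (true ∷ T) (true ∷ B) = cong suc (∣T∣≡∣T∩B∣+∣T─B∣ T B)
∣T∣≡∣T∩B∣+∣T─B∣ (true ∷ T) (false ∷ B) = trans (cong suc (∣T∣≡∣T∩B∣+∣T─B∣ T B)) (sym (+-suc _ _))
∣T∣≡∣T∩B∣+∣T─B∣ (false ∷ T) (true ∷ B) = ∣T∣≡∣T∩B∣+∣T─B∣ T B
∣T∣≡∣T∩B∣+∣T─B∣ (false ∷ T) (false ∷ B) = ∣T∣≡∣T∩B∣+∣T─B∣ T B

⊆ᵇ⇒∣∣≤ : ∀ {n} (S T : Subset n) → S ⊆ᵇ T → ∣ S ∣ ≤ ∣ T ∣
⊆ᵇ⇒∣∣≤ S T = p⊆q⇒∣p∣≤∣q∣ {p = S} {T} ∘ ⊆ᵇ⇒⊆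

⊆ᵇ-∣∣≥⇒≡ : ∀ {n} (S T : Subset n) → S ⊆ᵇ T → ∣ T ∣ ≤ ∣ S ∣ → S ≡ T
⊆ᵇ-∣∣≥⇒≡ [] [] _ _ = refl
⊆ᵇ-∣∣≥⇒≡ (true ∷ S) (true ∷ T) S⊆T ∣T∣≤∣S∣ = cong (true ∷_) (⊆ᵇ-∣∣≥⇒≡ S T (S⊆T ∘ suc) (≤-pred ∣T∣≤∣S∣))
⊆ᵇ-∣∣≥⇒≡ (true ∷ S) (false ∷ T) S⊆T _ with () ← S⊆T zero refl
⊆ᵇ-∣∣≥⇒≡ (false ∷ S) (true ∷ T) S⊆T ∣T∣≤∣S∣ = ⊥-elim (<⇒≱ (s≤s (⊆ᵇ⇒∣∣≤ S T (S⊆T ∘ suc))) ∣T∣≤∣S∣)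
⊆ᵇ-∣∣≥⇒≡ (false ∷ S) (false ∷ T) S⊆T ∣T∣≤∣S∣ = cong (false ∷_) (⊆ᵇ-∣∣≥⇒≡ S T (S⊆T ∘ suc) ∣T∣≤∣S∣)

subset-of-size : ∀ {n} k (Y : Subset n) → k ≤ ∣ Y ∣ → Σ (Subset n) λ S → S ⊆ᵇ Y × ∣ S ∣ ≡ k
subset-of-size {n} zero Y _ = ⊥ , (λ x → ⊥-elim ∘ ⊥!≢true x) , ∣⊥∣≡0 n
subset-of-size (suc k) (true ∷ Y) (s≤s k≤∣Y∣) with subset-of-size k Y k≤∣Y∣
... | S , S⊆Y , ∣S∣≡k = true ∷ S , (λ { zero _ → refl ; (suc x) → S⊆Y x }) , cong suc ∣S∣≡k
subset-of-size (suc k) (false ∷ Y) k<∣Y∣ with subset-of-size (suc k) Y k<∣Y∣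
... | S , S⊆Y , ∣S∣≡k = false ∷ S , (λ { zero () ; (suc x) → S⊆Y x }) , ∣S∣≡k

split-element : ∀ {n} p (P : Subset n) → ∣ P ∣ ≡ suc p →
  Σ (Fin n) λ v → Σ (Subset n) λ P′ → P ! v ≡ true × P′ ⊆ᵇ P × P′ ! v ≡ false × ∣ P′ ∣ ≡ p
split-element p (true ∷ P) ∣P∣≡1+p =
  zero , false ∷ P , refl , (λ { zero () ; (suc x) → id }) , refl , suc-injective ∣P∣≡1+p
split-element p (false ∷ P) ∣P∣≡1+p with split-element p P ∣P∣≡1+p
... | v , P′ , v∈P , P′⊆P , v∉P′ , ∣P′∣≡p =
  suc v , false ∷ P′ , v∈P , (λ { zero () ; (suc x) → P′⊆P x }) , v∉P′ , ∣P′∣≡p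

∣X∪Y∣≤∣X∣+∣Y∣ : ∀ {n} (X Y : Subset n) → ∣ X ∪ Y ∣ ≤ ∣ X ∣ + ∣ Y ∣
∣X∪Y∣≤∣X∣+∣Y∣ [] [] = z≤n
∣X∪Y∣≤∣X∣+∣Y∣ (true ∷ X) (true ∷ Y) =
  s≤s (≤-trans (∣X∪Y∣≤∣X∣+∣Y∣ X Y) (≤-trans (n≤1+n _) (≤-reflexive (sym (+-suc _ _)))))
∣X∪Y∣≤∣X∣+∣Y∣ (true ∷ X) (false ∷ Y) = s≤s (∣X∪Y∣≤∣X∣+∣Y∣ X Y)
∣X∪Y∣≤∣X∣+∣Y∣ (false ∷ X) (true ∷ Y) = ≤-trans (s≤s (∣X∪Y∣≤∣X∣+∣Y∣ X Y)) (≤-reflexive (sym (+-suc _ _)))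
∣X∪Y∣≤∣X∣+∣Y∣ (false ∷ X) (false ∷ Y) = ∣X∪Y∣≤∣X∣+∣Y∣ X Y

∣Y∪⁅x⁆∣≡1+∣Y∣ : ∀ {n} (Y : Subset n) x → Y ! x ≡ false → ∣ Y ∪ ⁅ x ⁆ ∣ ≡ suc ∣ Y ∣
∣Y∪⁅x⁆∣≡1+∣Y∣ (false ∷ Y) zero _ = cong (suc ∘ ∣_∣) (∪-identityʳ Y)
∣Y∪⁅x⁆∣≡1+∣Y∣ (true ∷ Y) (suc x) x∉Y = cong suc (∣Y∪⁅x⁆∣≡1+∣Y∣ Y x x∉Y)
∣Y∪⁅x⁆∣≡1+∣Y∣ (false ∷ Y) (suc x) x∉Y = ∣Y∪⁅x⁆∣≡1+∣Y∣ Y x x∉Y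

∣Y∣≡1+∣Y-x∣ : ∀ {n} (Y : Subset n) x → Y ! x ≡ true → ∣ Y ∣ ≡ suc ∣ Y - x ∣
∣Y∣≡1+∣Y-x∣ (true ∷ Y) zero _ = cong (suc ∘ ∣_∣) (sym (p─⊥≡p Y))
∣Y∣≡1+∣Y-x∣ (true ∷ Y) (suc x) x∈Y = cong suc (∣Y∣≡1+∣Y-x∣ Y x x∈Y)
∣Y∣≡1+∣Y-x∣ (false ∷ Y) (suc x) x∈Y = ∣Y∣≡1+∣Y-x∣ Y x x∈Y

_≟ˢ_ : ∀ {n} → DecidableEquality (Subset n)
_≟ˢ_ = ≡-dec _≟B_

disjoint-or-meets : ∀ {n} (X Y : Subset n) → Disjoint X Y ⊎ Meets X Y
disjoint-or-meets X Y with any? (λ x → (X ! x ∧ Y ! x) ≟B true)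
... | yes (x , x∈X∩Y) = inj₂ (x , ∧-elim x∈X∩Y)
... | no ¬meets = inj₁ (λ x x∈X x∈Y → ¬meets (x , ∧-intro x∈X x∈Y))

disjointᵇ : ∀ {n} → Subset n → Subset n → Bool
disjointᵇ X Y = does ((X ∩ Y) ≟ˢ ⊥)

disjointᵇ-sound : ∀ {n} (X Y : Subset n) → disjointᵇ X Y ≡ true → Disjoint X Y
disjointᵇ-sound X Y X∩Y≡⊥ x x∈X x∈Y = ⊥!≢true x (begin
    ⊥ ! x            ≡⟨ cong (_! x) (sym (does≡true⇒ ((X ∩ Y) ≟ˢ ⊥) X∩Y≡⊥)) ⟩
    (X ∩ Y) ! x      ≡⟨ !-∩ X Y x ⟩
    X ! x ∧ Y ! x    ≡⟨ ∧-intro x∈X x∈Y ⟩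
    true             ∎)
  where open ≡-Reasoning

disjointᵇ-complete : ∀ {n} (X Y : Subset n) → Disjoint X Y → disjointᵇ X Y ≡ true
disjointᵇ-complete X Y X∩Y=∅ = dec-true ((X ∩ Y) ≟ˢ ⊥) (subset-ext (X ∩ Y) ⊥ pointwise)
  where
  pointwise : ∀ i → (X ∩ Y) ! i ≡ ⊥ ! i
  pointwise i with X ! i in x∈X | Y ! i in x∈Y
  ... | true | true = ⊥-elim (X∩Y=∅ i x∈X x∈Y)
  ... | true | false = trans (!-∩ X Y i) (trans (cong₂ _∧_ x∈X x∈Y) (sym (lookup-replicate i false)))
  ... | false | _ = trans (!-∩ X Y i) (trans (cong₂ _∧_ x∈X x∈Y) (sym (lookup-replicate i false)))

nth : ∀ {m} (e : Subset m) → Fin ∣ e ∣ → Fin m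
nth (true ∷ e) zero = zero
nth (true ∷ e) (suc i) = suc (nth e i)
nth (false ∷ e) i = suc (nth e i)

nth-∈ : ∀ {m} (e : Subset m) i → e ! nth e i ≡ true
nth-∈ (true ∷ e) zero = refl
nth-∈ (true ∷ e) (suc i) = nth-∈ e i
nth-∈ (false ∷ e) i = nth-∈ e i

nth-injective : ∀ {m} (e : Subset m) i j → nth e i ≡ nth e j → i ≡ j
nth-injective (true ∷ e) zero zero _ = refl
nth-injective (true ∷ e) (suc i) (suc j) eq = cong suc (nth-injective e i j (Finₚ.suc-injective eq))
nth-injective (false ∷ e) i j eq = nth-injective e i j (Finₚ.suc-injective eq)

index : ∀ {m} (e : Subset m) x → e ! x ≡ true → Fin ∣ e ∣
index (true ∷ e) zero _ = zero
index (true ∷ e) (suc x) x∈e = suc (index e x x∈e)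
index (false ∷ e) (suc x) x∈e = index e x x∈e

nth-index : ∀ {m} (e : Subset m) x (x∈e : e ! x ≡ true) → nth e (index e x x∈e) ≡ x
nth-index (true ∷ e) zero _ = refl
nth-index (true ∷ e) (suc x) x∈e = cong suc (nth-index e x x∈e)
nth-index (false ∷ e) (suc x) x∈e = cong suc (nth-index e x x∈e)

nth′ : ∀ {m k} (e : Subset m) → ∣ e ∣ ≡ k → Fin k → Fin m
nth′ e refl = nth e

nth′-∈ : ∀ {m k} (e : Subset m) (∣e∣≡k : ∣ e ∣ ≡ k) i → e ! nth′ e ∣e∣≡k i ≡ true
nth′-∈ e refl = nth-∈ e

nth′-injective : ∀ {m k} (e : Subset m) (∣e∣≡k : ∣ e ∣ ≡ k) i j → nth′ e ∣e∣≡k i ≡ nth′ e ∣e∣≡k j → i ≡ j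
nth′-injective e refl = nth-injective e

nth′-surjective : ∀ {m k} (e : Subset m) (∣e∣≡k : ∣ e ∣ ≡ k) x → e ! x ≡ true →
  Σ (Fin k) λ i → nth′ e ∣e∣≡k i ≡ x
nth′-surjective e refl x x∈e = index e x x∈e , nth-index e x x∈e

sumFin : ∀ m → (Fin m → ℕ) → ℕ
sumFin zero f = 0
sumFin (suc m) f = f zero + sumFin m (f ∘ suc)

sumFin-≥ : ∀ m (f : Fin m → ℕ) i → f i ≤ sumFin m f
sumFin-≥ (suc m) f zero = m≤m+n _ _
sumFin-≥ (suc m) f (suc i) = ≤-trans (sumFin-≥ m (f ∘ suc) i) (m≤n+m _ _)

sumFin-mono-≤ : ∀ m {f g : Fin m → ℕ} → (∀ i → f i ≤ g i) → sumFin m f ≤ sumFin m g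
sumFin-mono-≤ zero _ = z≤n
sumFin-mono-≤ (suc m) f≤g = +-mono-≤ (f≤g zero) (sumFin-mono-≤ m (f≤g ∘ suc))

sumFin-size : ∀ {m} (W : Subset m) c → sumFin m (λ i → ⟦ W ! i ⟧ * c) ≡ ∣ W ∣ * c
sumFin-size [] c = refl
sumFin-size (true ∷ W) c = cong₂ _+_ (+-identityʳ c) (sumFin-size W c)
sumFin-size (false ∷ W) c = sumFin-size W c

sumSubsets-sumFin : ∀ n m (h : Fin m → Subset n → ℕ) →
  sumSubsets n (λ T → sumFin m (λ x → h x T)) ≡ sumFin m (λ x → sumSubsets n (h x))
sumSubsets-sumFin n zero h = sumSubsets-0 n
sumSubsets-sumFin n (suc m) h =
  trans (sumSubsets-+ n (h zero) (λ T → sumFin m (λ x → h (suc x) T)))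
        (cong (sumSubsets n (h zero) +_) (sumSubsets-sumFin n m (h ∘ suc)))

sumSubsets-≟ˢ : ∀ n (T : Subset n) → sumSubsets n (λ X → ⟦ does (X ≟ˢ T) ⟧) ≡ 1
sumSubsets-≟ˢ zero [] = refl
sumSubsets-≟ˢ (suc n) (true ∷ T) =
  trans (cong (_+ sumSubsets n (λ X → ⟦ does (X ≟ˢ T) ⟧)) (sumSubsets-0 n)) (sumSubsets-≟ˢ n T)
sumSubsets-≟ˢ (suc n) (false ∷ T) =
  trans (cong (sumSubsets n (λ X → ⟦ does (X ≟ˢ T) ⟧) +_) (sumSubsets-0 n))
        (trans (+-identityʳ _) (sumSubsets-≟ˢ n T))

length≤sumSubsets : ∀ n (L : List (Subset n)) (f : Subset n → ℕ) → Unique L →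
  (∀ T → T ∈ˡ L → 1 ≤ f T) → length L ≤ sumSubsets n f
length≤sumSubsets n [] f _ _ = z≤n
length≤sumSubsets n (T ∷ L) f (T∉L ∷ uniqueL) f≥1 = begin
    suc (length L)
  ≤⟨ s≤s (length≤sumSubsets n L f′ uniqueL f′≥1) ⟩
    suc (sumSubsets n f′)
  ≡⟨ +-comm 1 (sumSubsets n f′) ⟩
    sumSubsets n f′ + 1
  ≡⟨ cong (sumSubsets n f′ +_) (sym (sumSubsets-≟ˢ n T)) ⟩
    sumSubsets n f′ + sumSubsets n (λ X → ⟦ does (X ≟ˢ T) ⟧)
  ≡⟨ sym (sumSubsets-+ n f′ (λ X → ⟦ does (X ≟ˢ T) ⟧)) ⟩
    sumSubsets n (λ X → f′ X + ⟦ does (X ≟ˢ T) ⟧)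
  ≡⟨ sumSubsets-cong n restore ⟩
    sumSubsets n f
  ∎
  where
  open ≤-Reasoning
  f′ : Subset n → ℕ
  f′ X = f X ∸ ⟦ does (X ≟ˢ T) ⟧
  restore : ∀ X → f′ X + ⟦ does (X ≟ˢ T) ⟧ ≡ f X
  restore X with X ≟ˢ T
  ... | yes refl = m∸n+n≡m (f≥1 T (here refl))
  ... | no _ = +-identityʳ (f X)
  f′≥1 : ∀ X → X ∈ˡ L → 1 ≤ f′ X
  f′≥1 X X∈L with X ≟ˢ T
  ... | yes refl = ⊥-elim (All.lookup T∉L X∈L refl)
  ... | no _ = f≥1 X (there X∈L)

countSubsets : ∀ n → (Subset n → Bool) → ℕ
countSubsets n p = sumSubsets n (⟦_⟧ ∘ p)

enumerate : ∀ n → (Subset n → Bool) → List (Subset n)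
enumerate zero p = if p [] then [] ∷ [] else []
enumerate (suc n) p =
  map (false ∷_) (enumerate n (p ∘ (false ∷_))) ++ map (true ∷_) (enumerate n (p ∘ (true ∷_)))

enumerate-length : ∀ n p → length (enumerate n p) ≡ countSubsets n p
enumerate-length zero p with p []
... | true = refl
... | false = refl
enumerate-length (suc n) p = begin
    length (map (false ∷_) (enumerate n (p ∘ (false ∷_))) ++ map (true ∷_) (enumerate n (p ∘ (true ∷_))))
  ≡⟨ length-++ (map (false ∷_) (enumerate n (p ∘ (false ∷_)))) ⟩
    length (map (false ∷_) (enumerate n (p ∘ (false ∷_)))) + length (map (true ∷_) (enumerate n (p ∘ (true ∷_))))
  ≡⟨ cong₂ _+_ (trans (length-map (false ∷_) (enumerate n (p ∘ (false ∷_)))) (enumerate-length n _))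
               (trans (length-map (true ∷_) (enumerate n (p ∘ (true ∷_)))) (enumerate-length n _)) ⟩
    countSubsets (suc n) p
  ∎
  where open ≡-Reasoning

enumerate-unique : ∀ n p → Unique (enumerate n p)
enumerate-unique zero p with p []
... | true = All.[] ∷ []
... | false = []
enumerate-unique (suc n) p =
  Unique.++⁺ (Unique.map⁺ ∷-injectiveʳ (enumerate-unique n _)) (Unique.map⁺ ∷-injectiveʳ (enumerate-unique n _))
             disjoint
  where
  disjoint : ∀ {v} → ¬ (v ∈ˡ map (false ∷_) (enumerate n (p ∘ (false ∷_))) ×
                        v ∈ˡ map (true ∷_) (enumerate n (p ∘ (true ∷_))))
  disjoint (v∈₁ , v∈₂) with ∈-map⁻ (false ∷_) v∈₁ | ∈-map⁻ (true ∷_) v∈₂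
  ... | _ , _ , refl | _ , _ , ()

enumerate-sound : ∀ n p T → T ∈ˡ enumerate n p → p T ≡ true
enumerate-sound zero p [] T∈ with p []
enumerate-sound zero p [] (here refl) | true = refl
enumerate-sound zero p [] () | false
enumerate-sound (suc n) p T T∈ with ∈-++⁻ (map (false ∷_) (enumerate n (p ∘ (false ∷_)))) T∈
... | inj₁ T∈₁ with X , X∈ , refl ← ∈-map⁻ (false ∷_) T∈₁ = enumerate-sound n _ X X∈
... | inj₂ T∈₂ with X , X∈ , refl ← ∈-map⁻ (true ∷_) T∈₂ = enumerate-sound n _ X X∈

enumerate-complete : ∀ n p T → p T ≡ true → T ∈ˡ enumerate n p
enumerate-complete zero p [] pT rewrite pT = here refl
enumerate-complete (suc n) p (false ∷ T) pT = ∈-++⁺ˡ (∈-map⁺ (false ∷_) (enumerate-complete n _ T pT))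
enumerate-complete (suc n) p (true ∷ T) pT =
  ∈-++⁺ʳ (map (false ∷_) (enumerate n (p ∘ (false ∷_)))) (∈-map⁺ (true ∷_) (enumerate-complete n _ T pT))

Unique-map-injectiveOn : ∀ {A B : Set} (f : A → B) (L : List A) → Unique L →
  (∀ X Y → X ∈ˡ L → Y ∈ˡ L → f X ≡ f Y → X ≡ Y) → Unique (map f L)
Unique-map-injectiveOn f [] _ _ = []
Unique-map-injectiveOn f (X ∷ L) (X∉L ∷ uniqueL) inj =
  All.tabulate fX≢ ∷ Unique-map-injectiveOn f L uniqueL (λ P Q P∈ Q∈ → inj P Q (there P∈) (there Q∈))
  where
  fX≢ : ∀ {y} → y ∈ˡ map f L → f X ≢ y
  fX≢ y∈ fX≡y with Y , Y∈ , refl ← ∈-map⁻ f y∈ = All.lookup X∉L Y∈ (inj X Y (here refl) (there Y∈) fX≡y)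

countSubsets-injection : ∀ n (p q : Subset n → Bool) (f : Subset n → Subset n) →
  (∀ X → p X ≡ true → q (f X) ≡ true) →
  (∀ X Y → p X ≡ true → p Y ≡ true → f X ≡ f Y → X ≡ Y) →
  countSubsets n p ≤ countSubsets n q
countSubsets-injection n p q f pq inj = begin
    countSubsets n p
  ≡⟨ sym (enumerate-length n p) ⟩
    length (enumerate n p)
  ≡⟨ sym (length-map f (enumerate n p)) ⟩
    length (map f (enumerate n p))
  ≤⟨ length≤sumSubsets n (map f (enumerate n p)) (⟦_⟧ ∘ q) unique q≥1 ⟩
    countSubsets n q
  ∎
  where
  open ≤-Reasoning
  unique : Unique (map f (enumerate n p))
  unique = Unique-map-injectiveOn f (enumerate n p) (enumerate-unique n p)
             (λ X Y X∈ Y∈ → inj X Y (enumerate-sound n p X X∈) (enumerate-sound n p Y Y∈))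
  q≥1 : ∀ T → T ∈ˡ map f (enumerate n p) → 1 ≤ ⟦ q T ⟧
  q≥1 T T∈ with X , X∈ , refl ← ∈-map⁻ f T∈ = ≤-reflexive (cong ⟦_⟧ (sym (pq X (enumerate-sound n p X X∈))))

sumSubsets-─ : ∀ n (W : Subset n) (g : Subset n → ℕ) →
  sumSubsets n (λ T → g (T ─ W)) ≤ 2 ^ ∣ W ∣ * sumSubsets n g
sumSubsets-─ zero [] g = ≤-reflexive (sym (+-identityʳ _))
sumSubsets-─ (suc n) (false ∷ W) g = begin
    sumSubsets n (λ T → g (false ∷ (T ─ W))) + sumSubsets n (λ T → g (true ∷ (T ─ W)))
  ≤⟨ +-mono-≤ (sumSubsets-─ n W (g ∘ (false ∷_))) (sumSubsets-─ n W (g ∘ (true ∷_))) ⟩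
    2 ^ ∣ W ∣ * sumSubsets n (g ∘ (false ∷_)) + 2 ^ ∣ W ∣ * sumSubsets n (g ∘ (true ∷_))
  ≡⟨ sym (*-distribˡ-+ (2 ^ ∣ W ∣) _ _) ⟩
    2 ^ ∣ W ∣ * sumSubsets (suc n) g
  ∎
  where open ≤-Reasoning
sumSubsets-─ (suc n) (true ∷ W) g = begin
    sumSubsets n (λ T → g (false ∷ (T ─ W))) + sumSubsets n (λ T → g (false ∷ (T ─ W)))
  ≤⟨ +-mono-≤ (sumSubsets-─ n W (g ∘ (false ∷_))) (sumSubsets-─ n W (g ∘ (false ∷_))) ⟩
    x + x
  ≤⟨ m≤m+n (x + x) (y + y) ⟩
    x + x + (y + y)
  ≡⟨ regroup (2 ^ ∣ W ∣) (sumSubsets n (g ∘ (false ∷_))) (sumSubsets n (g ∘ (true ∷_))) ⟩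
    2 ^ suc ∣ W ∣ * sumSubsets (suc n) g
  ∎
  where
  open ≤-Reasoning
  x = 2 ^ ∣ W ∣ * sumSubsets n (g ∘ (false ∷_))
  y = 2 ^ ∣ W ∣ * sumSubsets n (g ∘ (true ∷_))
  regroup : ∀ a b c → a * b + a * b + (a * c + a * c) ≡ (2 * a) * (b + c)
  regroup = solve-∀

codegree-bound : ∀ {n} d (v z : Fin n) → z ≢ v →
  countSubsets n (λ e → e ! v ∧ (e ! z ∧ (∣ e ∣ ≡ᵇ suc (suc d)))) ≤ suc n ^ d
codegree-bound {n} d v z z≢v = begin
    countSubsets n through-v-z
  ≤⟨ countSubsets-injection n through-v-z (λ Y → ∣ Y ∣ ≡ᵇ d) (λ e → e - v - z) shrink-size shrink-injective ⟩
    sumSizes n (λ j → ⟦ j ≡ᵇ d ⟧)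
  ≤⟨ sumSizes-≤-^ n d _ (λ j → ⟦⟧≤1 (j ≡ᵇ d)) (λ j d<j → cong ⟦_⟧ (≡ᵇ-false (>⇒≢ d<j))) ⟩
    suc n ^ d
  ∎
  where
  open ≤-Reasoning
  through-v-z : Subset n → Bool
  through-v-z e = e ! v ∧ (e ! z ∧ (∣ e ∣ ≡ᵇ suc (suc d)))
  v∈ : ∀ X → through-v-z X ≡ true → X ! v ≡ true
  v∈ X = proj₁ ∘ ∧-elim
  z∈ : ∀ X → through-v-z X ≡ true → X ! z ≡ true
  z∈ X = proj₁ ∘ ∧-elim ∘ proj₂ ∘ ∧-elim {X ! v}
  shrink-size : ∀ X → through-v-z X ≡ true → (∣ X - v - z ∣ ≡ᵇ d) ≡ true
  shrink-size X X-ok with v∈X , X-ok′ ← ∧-elim X-ok with z∈X , ∣X∣≡k ← ∧-elim X-ok′ =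
    ≡ᵇ-true (suc-injective (suc-injective (begin-equality
      suc (suc ∣ X - v - z ∣) ≡⟨ cong suc (sym (∣Y∣≡1+∣Y-x∣ (X - v) z (trans (!-remove X z≢v) z∈X))) ⟩
      suc ∣ X - v ∣           ≡⟨ sym (∣Y∣≡1+∣Y-x∣ X v v∈X) ⟩
      ∣ X ∣                   ≡⟨ ≡ᵇ⇒≡ ∣ X ∣ (suc (suc d)) (Equivalence.from T-≡ ∣X∣≡k) ⟩
      suc (suc d)             ∎)))
  shrink-injective : ∀ X Y → through-v-z X ≡ true → through-v-z Y ≡ true → X - v - z ≡ Y - v - z → X ≡ Y
  shrink-injective X Y X-ok Y-ok X′≡Y′ = subset-ext X Y pointwise
    where
    pointwise : ∀ i → X ! i ≡ Y ! i
    pointwise i with i Finₚ.≟ v | i Finₚ.≟ z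
    ... | yes refl | _ = trans (v∈ X X-ok) (sym (v∈ Y Y-ok))
    ... | no _ | yes refl = trans (z∈ X X-ok) (sym (z∈ Y Y-ok))
    ... | no i≢v | no i≢z = trans (sym (trans (!-remove (X - v) i≢z) (!-remove X i≢v)))
                             (trans (cong (_! i) X′≡Y′) (trans (!-remove (Y - v) i≢z) (!-remove Y i≢v)))

small-subsets-bound : ∀ n d → countSubsets n (λ Y → ∣ Y ∣ ≤ᵇ d) ≤ suc n ^ d
small-subsets-bound n d =
  sumSizes-≤-^ n d (λ j → ⟦ j ≤ᵇ d ⟧) (λ j → ⟦⟧≤1 (j ≤ᵇ d)) (λ j d<j → cong ⟦_⟧ (≤ᵇ-false (<⇒≱ d<j)))

block : ∀ t k → Fin t → Subset (t * k)
block t k i = tabulate (λ v → does (quotient {t} k v Finₚ.≟ i))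

block-edge : ∀ t k i → Edge (Matching t k) (block t k i)
block-edge t k i = i , λ v → mk⇔
  (λ v∈ → does≡true⇒ (quotient {t} k v Finₚ.≟ i) (trans (sym (lookup∘tabulate _ v)) (∈⇒! v∈)))
  (λ q≡i → !⇒∈ (trans (lookup∘tabulate _ v) (dec-true (quotient {t} k v Finₚ.≟ i) q≡i)))

matching⇒transversal-size : ∀ {n t k} (G : Hypergraph n) (A : Subset n) →
  (∀ e → Edge G e → Meets e A) → Contains G (Matching t k) → t ≤ ∣ A ∣
matching⇒transversal-size {t = t} {k} G A meetsA (f , f-injective , f-edge) =
  ≮⇒≥ (λ ∣A∣<t → collision (pigeonhole ∣A∣<t slot))
  where
  open ≡-Reasoning
  hit : ∀ i → Σ (Fin (t * k)) λ x → quotient {t} k x ≡ i × A ! f x ≡ true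
  hit i
    with e′ , e′-edge , e′≡image ← f-edge (block t k i) (block-edge t k i)
    with a , a∈e′ , a∈A ← meetsA e′ e′-edge
    with x , x∈block , refl ← Equivalence.to (e′≡image a) (!⇒∈ a∈e′)
    = x , Equivalence.to (proj₂ (block-edge t k i) x) x∈block , a∈A
  preimage : Fin t → Fin (t * k)
  preimage i = proj₁ (hit i)
  block-of : ∀ i → quotient {t} k (preimage i) ≡ i
  block-of i = proj₁ (proj₂ (hit i))
  slot : Fin t → Fin ∣ A ∣
  slot i = index A (f (preimage i)) (proj₂ (proj₂ (hit i)))
  collision : (Σ (Fin t) λ i → Σ (Fin t) λ j → i Fin.< j × slot i ≡ slot j) → Empty
  collision (i , j , i<j , slot-i≡slot-j) = <⇒≢ i<j (cong Fin.toℕ (begin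
      i                           ≡⟨ sym (block-of i) ⟩
      quotient {t} k (preimage i) ≡⟨ cong (quotient {t} k) (f-injective _ _ same-image) ⟩
      quotient {t} k (preimage j) ≡⟨ block-of j ⟩
      j                           ∎))
    where
    same-image : f (preimage i) ≡ f (preimage j)
    same-image = begin
      f (preimage i)  ≡⟨ sym (nth-index A _ _) ⟩
      nth A (slot i)  ≡⟨ cong (nth A) slot-i≡slot-j ⟩
      nth A (slot j)  ≡⟨ nth-index A _ _ ⟩
      f (preimage j)  ∎

DisjointFamily : ∀ {n} → (Subset n → Set) → List (Subset n) → Set
DisjointFamily P [] = Unit
DisjointFamily P (e ∷ es) = P e × Disjoint e (⋃ es) × DisjointFamily P es

DisjointFamily-map : ∀ {n} {P Q : Subset n → Set} → (∀ e → P e → Q e) → ∀ es →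
  DisjointFamily P es → DisjointFamily Q es
DisjointFamily-map P⇒Q [] tt = tt
DisjointFamily-map P⇒Q (e ∷ es) (Pe , e∩⋃es=∅ , family) = P⇒Q e Pe , e∩⋃es=∅ , DisjointFamily-map P⇒Q es family

lookup-⊆ᵇ-⋃ : ∀ {n} (es : List (Subset n)) i → List.lookup es i ⊆ᵇ ⋃ es
lookup-⊆ᵇ-⋃ (e ∷ es) zero x x∈e = trans (!-∪ e (⋃ es) x) (∨-introˡ _ x∈e)
lookup-⊆ᵇ-⋃ (e ∷ es) (suc i) x x∈eᵢ = trans (!-∪ e (⋃ es) x) (∨-introʳ (e ! x) (lookup-⊆ᵇ-⋃ es i x x∈eᵢ))

DisjointFamily-lookup : ∀ {n} {P : Subset n → Set} es → DisjointFamily P es → ∀ i → P (List.lookup es i)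
DisjointFamily-lookup (e ∷ es) (Pe , _ , _) zero = Pe
DisjointFamily-lookup (e ∷ es) (_ , _ , family) (suc i) = DisjointFamily-lookup es family i

DisjointFamily-disjoint : ∀ {n} {P : Subset n → Set} es → DisjointFamily P es →
  ∀ i j → i ≢ j → Disjoint (List.lookup es i) (List.lookup es j)
DisjointFamily-disjoint (e ∷ es) _ zero zero i≢j = ⊥-elim (i≢j refl)
DisjointFamily-disjoint (e ∷ es) (_ , e∩⋃es=∅ , _) zero (suc j) _ x x∈e x∈eⱼ =
  e∩⋃es=∅ x x∈e (lookup-⊆ᵇ-⋃ es j x x∈eⱼ)
DisjointFamily-disjoint (e ∷ es) (_ , e∩⋃es=∅ , _) (suc i) zero _ x x∈eᵢ x∈e =
  e∩⋃es=∅ x x∈e (lookup-⊆ᵇ-⋃ es i x x∈eᵢ)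
DisjointFamily-disjoint (e ∷ es) (_ , _ , family) (suc i) (suc j) i≢j =
  DisjointFamily-disjoint es family i j (i≢j ∘ cong suc)

disjointEdges⇒matching : ∀ {n k} (G : Hypergraph n) es →
  DisjointFamily (λ e → Edge G e × ∣ e ∣ ≡ k) es → Contains G (Matching (length es) k)
disjointEdges⇒matching {n} {k} G es family = f , f-injective , f-edge
  where
  t = length es
  E : Fin t → Subset n
  E = List.lookup es
  E-edge : ∀ i → Edge G (E i)
  E-edge i = proj₁ (DisjointFamily-lookup es family i)
  ∣E∣≡k : ∀ i → ∣ E i ∣ ≡ k
  ∣E∣≡k i = proj₂ (DisjointFamily-lookup es family i)
  g : Fin t × Fin k → Fin n
  g (i , r) = nth′ (E i) (∣E∣≡k i) r
  g-injective : ∀ a b → g a ≡ g b → a ≡ b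
  g-injective (i , r) (j , r′) g≡ with i Finₚ.≟ j
  ... | yes refl = cong (i ,_) (nth′-injective (E i) (∣E∣≡k i) r r′ g≡)
  ... | no i≢j = ⊥-elim (DisjointFamily-disjoint es family i j i≢j (g (j , r′))
                   (subst (λ y → E i ! y ≡ true) g≡ (nth′-∈ (E i) (∣E∣≡k i) r)) (nth′-∈ (E j) (∣E∣≡k j) r′))
  f : Fin (t * k) → Fin n
  f = g ∘ remQuot {t} k
  f-injective : ∀ x y → f x ≡ f y → x ≡ y
  f-injective x y fx≡fy = begin
      x                                  ≡⟨ sym (combine-remQuot {t} k x) ⟩
      uncurry combine (remQuot {t} k x)  ≡⟨ cong (uncurry combine) (g-injective _ _ fx≡fy) ⟩
      uncurry combine (remQuot {t} k y)  ≡⟨ combine-remQuot {t} k y ⟩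
      y                                  ∎
    where open ≡-Reasoning
  f-edge : ∀ e → Edge (Matching t k) e →
    Σ (Subset n) λ e′ → Edge G e′ × (∀ y → (y ∈ e′) ⇔ (Σ (Fin (t * k)) λ x → (x ∈ e) × (f x ≡ y)))
  f-edge e (i , e≡block) = E i , E-edge i , λ y → mk⇔ (to y) from
    where
    to : ∀ y → y ∈ E i → Σ (Fin (t * k)) λ x → (x ∈ e) × (f x ≡ y)
    to y y∈Eᵢ with r , gᵢr≡y ← nth′-surjective (E i) (∣E∣≡k i) y (∈⇒! y∈Eᵢ) =
      combine i r , Equivalence.from (e≡block (combine i r)) (cong proj₁ (remQuot-combine i r)) ,
      trans (cong g (remQuot-combine i r)) gᵢr≡y
    from : ∀ {y} → (Σ (Fin (t * k)) λ x → (x ∈ e) × (f x ≡ y)) → y ∈ E i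
    from (x , x∈e , refl) = !⇒∈ (subst (λ j → E j ! f x ≡ true) (Equivalence.to (e≡block x) x∈e)
                                   (nth′-∈ (E (quotient {t} k x)) (∣E∣≡k _) (proj₂ (remQuot {t} k x))))

EveryKSubset : ∀ {n} → ℕ → (Subset n → Set) → Subset n → Set
EveryKSubset k P T = ∀ S → S ⊆ᵇ T → ∣ S ∣ ≡ k → P S

bigClique⇒everyKSubset : ∀ {n k} (G : Hypergraph n) → 2 ≤ k → Uniform k G → ∀ T →
  IsBigClique k G T → k ≤ ∣ T ∣ × EveryKSubset k (Edge G) T
bigClique⇒everyKSubset G k≥2 uniform T (k≤∣T∣ , inj₁ ∣T∣≡1) = ⊥-elim (<⇒≱ k≥2 (≤-trans k≤∣T∣ (≤-reflexive ∣T∣≡1)))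
bigClique⇒everyKSubset {k = k} G k≥2 uniform T (k≤∣T∣ , inj₂ (inj₁ (e , e-edge , T⊆e))) = k≤∣T∣ , only-T
  where
  T≡e : T ≡ e
  T≡e = ⊆ᵇ-∣∣≥⇒≡ T e (⊆⇒⊆ᵇ T⊆e) (≤-trans (≤-reflexive (uniform e e-edge)) k≤∣T∣)
  only-T : EveryKSubset k (Edge G) T
  only-T S S⊆T ∣S∣≡k = subst (Edge G) (sym (trans S≡T T≡e)) e-edge
    where
    S≡T : S ≡ T
    S≡T = ⊆ᵇ-∣∣≥⇒≡ S T S⊆T (≤-reflexive (trans (trans (cong ∣_∣ T≡e) (uniform e e-edge)) (sym ∣S∣≡k)))
bigClique⇒everyKSubset G k≥2 uniform T (k≤∣T∣ , inj₂ (inj₂ all-edges)) =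
  k≤∣T∣ , λ S S⊆T ∣S∣≡k → all-edges S (⊆ᵇ⇒⊆ S⊆T) ∣S∣≡k

everyKSubset⇒bigClique : ∀ {n k} (G : Hypergraph n) T → k ≤ ∣ T ∣ → EveryKSubset k (Edge G) T → IsBigClique k G T
everyKSubset⇒bigClique G T k≤∣T∣ all-edges = k≤∣T∣ , inj₂ (inj₂ (λ S S⊆T ∣S∣≡k → all-edges S (⊆⇒⊆ᵇ S⊆T) ∣S∣≡k))

∣T─X∣<k : ∀ {n k} {P : Subset n → Set} (X T : Subset n) → (∀ e → P e → Meets e X) → EveryKSubset k P T →
  ∣ T ─ X ∣ < k
∣T─X∣<k {k = k} X T X-meets-all T-closed = ≰⇒> (no-large-subset ∘ subset-of-size k (T ─ X))
  where
  no-large-subset : (Σ (Subset _) λ S → S ⊆ᵇ (T ─ X) × ∣ S ∣ ≡ k) → Empty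
  no-large-subset (S , S⊆T─X , ∣S∣≡k)
    with x , x∈S , x∈X ← X-meets-all S (T-closed S (λ y → ─⊆ᵇ T X y ∘ S⊆T─X y) ∣S∣≡k)
    with () ← trans (sym (─⇒∉ T X x (S⊆T─X x x∈S))) x∈X

module Families {n} (k : ℕ) (isEdge : Subset n → Bool) (isEdge-size : ∀ e → isEdge e ≡ true → ∣ e ∣ ≡ k) where

  Family : List (Subset n) → Set
  Family = DisjointFamily (λ e → isEdge e ≡ true)

  ∣⋃∣≤k*length : ∀ es → Family es → ∣ ⋃ es ∣ ≤ k * length es
  ∣⋃∣≤k*length [] _ = ≤-reflexive (trans (∣⊥∣≡0 n) (sym (*-zeroʳ k)))
  ∣⋃∣≤k*length (e ∷ es) (e-edge , _ , family) = begin
      ∣ e ∪ ⋃ es ∣         ≤⟨ ∣X∪Y∣≤∣X∣+∣Y∣ e (⋃ es) ⟩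
      ∣ e ∣ + ∣ ⋃ es ∣     ≤⟨ +-mono-≤ (≤-reflexive (isEdge-size e e-edge)) (∣⋃∣≤k*length es family) ⟩
      k + k * length es    ≡⟨ sym (*-suc k (length es)) ⟩
      k * suc (length es)  ∎
    where open ≤-Reasoning

  Rich : ℕ → Fin n → Set
  Rich c v = ∀ Z → ∣ Z ∣ ≤ c → Z ! v ≡ false →
    Σ (Subset n) λ e → isEdge e ≡ true × e ! v ≡ true × Disjoint e Z

  Transversal : Subset n → Set
  Transversal X = ∀ e → isEdge e ≡ true → Meets e X

  extend-through-rich : ∀ {t} p (P : Subset n) es → ∣ P ∣ ≡ p → (∀ v → P ! v ≡ true → Rich (k * t + t) v) →
    Family es → Disjoint (⋃ es) P → length es + p ≡ t →
    Σ (List (Subset n)) λ es′ → Family es′ × length es′ ≡ t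
  extend-through-rich zero P es _ _ family _ es+0≡t = es , family , trans (sym (+-identityʳ _)) es+0≡t
  extend-through-rich {t} (suc p) P es ∣P∣≡1+p P-rich family ⋃es∩P=∅ es+p≡t
    with v , P′ , v∈P , P′⊆P , v∉P′ , ∣P′∣≡p ← split-element p P ∣P∣≡1+p
    = add-edge-through-v (P-rich v v∈P Z ∣Z∣≤ v∉Z)
    where
    Z : Subset n
    Z = ⋃ es ∪ P′
    ∣Z∣≤ : ∣ Z ∣ ≤ k * t + t
    ∣Z∣≤ = ≤-trans (∣X∪Y∣≤∣X∣+∣Y∣ (⋃ es) P′)
             (+-mono-≤ (≤-trans (∣⋃∣≤k*length es family) (*-monoʳ-≤ k (≤-trans (m≤m+n _ _) (≤-reflexive es+p≡t))))
                       (≤-trans (≤-reflexive ∣P′∣≡p) (≤-trans (n≤1+n p) (≤-trans (m≤n+m _ _) (≤-reflexive es+p≡t)))))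
    v∉Z : Z ! v ≡ false
    v∉Z with (⋃ es) ! v in v∈⋃es
    ... | true = ⊥-elim (⋃es∩P=∅ v v∈⋃es v∈P)
    ... | false = trans (!-∪ (⋃ es) P′ v) (cong₂ _∨_ v∈⋃es v∉P′)
    add-edge-through-v : (Σ (Subset n) λ e → isEdge e ≡ true × e ! v ≡ true × Disjoint e Z) →
      Σ (List (Subset n)) λ es′ → Family es′ × length es′ ≡ t
    add-edge-through-v (e , e-edge , v∈e , e∩Z=∅) =
      extend-through-rich p P′ (e ∷ es) ∣P′∣≡p (λ w w∈P′ → P-rich w (P′⊆P w w∈P′))
        (e-edge , e∩⋃es=∅ , family) ⋃∩P′=∅ (trans (sym (+-suc _ _)) es+p≡t)
      where
      e∩⋃es=∅ : Disjoint e (⋃ es)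
      e∩⋃es=∅ x x∈e x∈⋃es = e∩Z=∅ x x∈e (trans (!-∪ (⋃ es) P′ x) (∨-introˡ _ x∈⋃es))
      ⋃∩P′=∅ : Disjoint (e ∪ ⋃ es) P′
      ⋃∩P′=∅ x x∈⋃ x∈P′ with ∨-elim (trans (sym (!-∪ e (⋃ es) x)) x∈⋃)
      ... | inj₁ x∈e = e∩Z=∅ x x∈e (trans (!-∪ (⋃ es) P′ x) (∨-introʳ _ x∈P′))
      ... | inj₂ x∈⋃es = ⋃es∩P=∅ x x∈⋃es (P′⊆P x x∈P′)

  maximal-family : ∀ {t} room es → Family es → length es + room ≡ t →
    (Σ (List (Subset n)) λ es′ → Family es′ × length es′ ≡ t) ⊎
    (Σ (List (Subset n)) λ es′ → Family es′ × length es′ < t × Transversal (⋃ es′))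
  maximal-family zero es family es+0≡t = inj₁ (es , family , trans (sym (+-identityʳ _)) es+0≡t)
  maximal-family (suc room) es family es+room≡t
    with anySubset? (λ e → (isEdge e ∧ disjointᵇ e (⋃ es)) ≟B true)
  ... | yes (e , e-free) with e-edge , e∩⋃es=∅ ← ∧-elim e-free =
    maximal-family room (e ∷ es) (e-edge , disjointᵇ-sound e (⋃ es) e∩⋃es=∅ , family)
      (trans (sym (+-suc _ _)) es+room≡t)
  ... | no no-free-edge =
    inj₂ (es , family , ≤-trans (s≤s (m≤m+n _ room)) (≤-reflexive (trans (sym (+-suc _ _)) es+room≡t)) ,
          ⋃es-meets-all)
    where
    ⋃es-meets-all : Transversal (⋃ es)
    ⋃es-meets-all e e-edge with disjoint-or-meets e (⋃ es)
    ... | inj₁ e∩⋃es=∅ = ⊥-elim (no-free-edge (e , ∧-intro e-edge (disjointᵇ-complete e (⋃ es) e∩⋃es=∅)))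
    ... | inj₂ meets = meets

-- Upper bound

-- Bounds, in units of (n + 1)^(k − 2), the cliques that are not counted by their profile with
-- respect to the heavy vertices.
errorConstant : ℕ → ℕ → ℕ
errorConstant d s = (k * s) * (2 ^ (k * s) * (k * suc s + suc s)) + 2 ^ (k * s)
  where k = suc (suc d)

module UpperBound (d s n : ℕ) (G : Hypergraph n) (uniform : Uniform (suc (suc d)) G)
  (M-free : ¬ Contains G (Matching (suc s) (suc (suc d))))
  (L : List (Subset n)) (L-unique : Unique L) (L-cliques : ∀ T → (T ∈ˡ L) ⇔ IsBigClique (suc (suc d)) G T) where

  open import Data.List.Membership.DecPropositional (_≟ˢ_ {n}) using (_∈?_)

  k t : ℕ
  k = suc (suc d)
  t = suc s

  -- Edge G need not be decidable, but the edges are exactly the k-sets in the clique list L.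
  isEdge : Subset n → Bool
  isEdge e = does (e ∈? L) ∧ (∣ e ∣ ≡ᵇ k)

  isEdge-size : ∀ e → isEdge e ≡ true → ∣ e ∣ ≡ k
  isEdge-size e e-edge = ≡ᵇ⇒≡ ∣ e ∣ k (Equivalence.from T-≡ (proj₂ (∧-elim e-edge)))

  clique-edges : ∀ T → T ∈ˡ L → k ≤ ∣ T ∣ × EveryKSubset k (Edge G) T
  clique-edges T T∈L = bigClique⇒everyKSubset G (s≤s (s≤s z≤n)) uniform T (Equivalence.to (L-cliques T) T∈L)

  isEdge⇒Edge : ∀ e → isEdge e ≡ true → Edge G e
  isEdge⇒Edge e e-edge =
    proj₂ (clique-edges e (does≡true⇒ (e ∈? L) (proj₁ (∧-elim e-edge)))) e (λ _ → id) (isEdge-size e e-edge)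

  Edge⇒isEdge : ∀ e → Edge G e → isEdge e ≡ true
  Edge⇒isEdge e e-edge = ∧-intro
    (dec-true (e ∈? L) (Equivalence.from (L-cliques e)
      (≤-reflexive (sym (uniform e e-edge)) , inj₂ (inj₁ (e , e-edge , id)))))
    (≡ᵇ-true (uniform e e-edge))

  clique-isEdges : ∀ T → T ∈ˡ L → k ≤ ∣ T ∣ × EveryKSubset k (λ S → isEdge S ≡ true) T
  clique-isEdges T T∈L with k≤∣T∣ , T-edges ← clique-edges T T∈L =
    k≤∣T∣ , λ S S⊆T ∣S∣≡k → Edge⇒isEdge S (T-edges S S⊆T ∣S∣≡k)

  open Families k isEdge isEdge-size

  no-t-family : ∀ es → Family es → length es ≢ t
  no-t-family es family ∣es∣≡t = M-free (subst (λ m → Contains G (Matching m k)) ∣es∣≡t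
    (disjointEdges⇒matching G es
      (DisjointFamily-map (λ e e-edge → isEdge⇒Edge e e-edge , isEdge-size e e-edge) es family)))

  u : ℕ
  u = suc n ^ d

  degree : Fin n → ℕ
  degree v = countSubsets n (λ e → e ! v ∧ isEdge e)

  threshold : ℕ
  threshold = (k * t + t) * u

  heavy : Subset n
  heavy = tabulate (λ v → threshold <ᵇ degree v)

  light⇒degree≤ : ∀ v → heavy ! v ≡ false → degree v ≤ threshold
  light⇒degree≤ v v-light = ≮⇒≥ (λ threshold<degree → false≢true (trans (sym v-light)
    (trans (lookup∘tabulate (λ w → threshold <ᵇ degree w) v) (<ᵇ-true threshold<degree))))

  degree≤∣Z∣*u : ∀ v Z → Z ! v ≡ false → (∀ e → (e ! v ∧ isEdge e) ≡ true → Meets e Z) → degree v ≤ ∣ Z ∣ * u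
  degree≤∣Z∣*u v Z v∉Z edges-meet-Z = begin
      degree v
    ≤⟨ sumSubsets-mono-≤ n counted-via-Z ⟩
      sumSubsets n (λ e → sumFin n (λ z → through z e))
    ≡⟨ sumSubsets-sumFin n n through ⟩
      sumFin n (λ z → sumSubsets n (through z))
    ≤⟨ sumFin-mono-≤ n codegree≤ ⟩
      sumFin n (λ z → ⟦ Z ! z ⟧ * u)
    ≡⟨ sumFin-size Z u ⟩
      ∣ Z ∣ * u
    ∎
    where
    open ≤-Reasoning
    through : Fin n → Subset n → ℕ
    through z e = ⟦ Z ! z ⟧ * ⟦ e ! v ∧ (e ! z ∧ (∣ e ∣ ≡ᵇ k)) ⟧
    counted-via-Z : ∀ e → ⟦ e ! v ∧ isEdge e ⟧ ≤ sumFin n (λ z → through z e)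
    counted-via-Z e with e ! v ∧ isEdge e in e-ok
    ... | false = z≤n
    ... | true with z , z∈e , z∈Z ← edges-meet-Z e e-ok
                 with v∈e , e-edge ← ∧-elim {e ! v} e-ok =
      ≤-trans (≤-reflexive (sym through-z)) (sumFin-≥ n (λ z → through z e) z)
      where
      through-z : through z e ≡ 1
      through-z = cong₂ (λ a b → ⟦ a ⟧ * ⟦ b ⟧) z∈Z
        (∧-intro {e ! v} v∈e (∧-intro {e ! z} z∈e (proj₂ (∧-elim {does (e ∈? L)} e-edge))))
    codegree≤ : ∀ z → sumSubsets n (through z) ≤ ⟦ Z ! z ⟧ * u
    codegree≤ z with Z ! z in z∈Z
    ... | false = ≤-reflexive (sumSubsets-0 n)
    ... | true = ≤-trans (≤-reflexive (sumSubsets-* n 1 _)) (*-monoʳ-≤ 1 (codegree-bound d v z z≢v))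
      where
      z≢v : z ≢ v
      z≢v refl = false≢true (trans (sym v∉Z) z∈Z)

  heavy⇒rich : ∀ v → heavy ! v ≡ true → Rich (k * t + t) v
  heavy⇒rich v v-heavy Z ∣Z∣≤ v∉Z with anySubset? (λ e → (e ! v ∧ (isEdge e ∧ disjointᵇ e Z)) ≟B true)
  ... | yes (e , e-ok) with v∈e , e-ok′ ← ∧-elim {e ! v} e-ok with e-edge , e∩Z=∅ ← ∧-elim {isEdge e} e-ok′ =
    e , e-edge , v∈e , disjointᵇ-sound e Z e∩Z=∅
  ... | no no-edge-avoids-Z = ⊥-elim (<⇒≱ threshold<degree (begin
      degree v         ≤⟨ degree≤∣Z∣*u v Z v∉Z edges-meet-Z ⟩
      ∣ Z ∣ * u        ≤⟨ *-monoˡ-≤ u ∣Z∣≤ ⟩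
      threshold        ∎))
    where
    open ≤-Reasoning
    threshold<degree : threshold < degree v
    threshold<degree = <ᵇ⇒< threshold (degree v)
      (Equivalence.from T-≡ (trans (sym (lookup∘tabulate (λ w → threshold <ᵇ degree w) v)) v-heavy))
    edges-meet-Z : ∀ e → (e ! v ∧ isEdge e) ≡ true → Meets e Z
    edges-meet-Z e e-ok with ∧-elim {e ! v} e-ok | disjoint-or-meets e Z
    ... | _ | inj₂ meets = meets
    ... | v∈e , e-edge | inj₁ e∩Z=∅ =
      ⊥-elim (no-edge-avoids-Z (e , ∧-intro {e ! v} v∈e (∧-intro {isEdge e} e-edge (disjointᵇ-complete e Z e∩Z=∅))))

  coverWeight-of-clique : ∀ X T → T ∈ˡ L → ∣ T ─ X ∣ < k → coverWeight k ∣ T ∩ X ∣ ∣ T ─ X ∣ ≡ 1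
  coverWeight-of-clique X T T∈L ∣T─X∣<k =
    coverWeight-intro k _ _ ∣T─X∣<k (≤-trans (proj₁ (clique-isEdges T T∈L)) (≤-reflexive (∣T∣≡∣T∩B∣+∣T─B∣ T X)))

  transversal-bound : ∀ X → Transversal X → length L ≤ coverCount k ∣ X ∣ (n ∸ ∣ X ∣)
  transversal-bound X X-transversal = begin
      length L
    ≤⟨ length≤sumSubsets n L (λ T → coverWeight k ∣ T ∩ X ∣ ∣ T ─ X ∣) L-unique counted ⟩
      sumSubsets n (λ T → coverWeight k ∣ T ∩ X ∣ ∣ T ─ X ∣)
    ≡⟨ sumSubsets-coverWeight≡coverCount n k X ⟩
      coverCount k ∣ X ∣ (n ∸ ∣ X ∣)
    ∎
    where
    open ≤-Reasoning
    counted : ∀ T → T ∈ˡ L → 1 ≤ coverWeight k ∣ T ∩ X ∣ ∣ T ─ X ∣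
    counted T T∈L = ≤-reflexive (sym (coverWeight-of-clique X T T∈L
                      (∣T─X∣<k X T X-transversal (proj₂ (clique-isEdges T T∈L)))))

  too-many-heavy : s < ∣ heavy ∣ → Empty
  too-many-heavy s<∣heavy∣
    with P , P⊆heavy , ∣P∣≡t ← subset-of-size t heavy s<∣heavy∣
    with es , family , ∣es∣≡t ← extend-through-rich t P [] ∣P∣≡t (λ v v∈P → heavy⇒rich v (P⊆heavy v v∈P))
                                  tt (λ x x∈⊥ _ → ⊥!≢true x x∈⊥) refl
    = no-t-family es family ∣es∣≡t

  heavy-transversal : ∣ heavy ∣ ≡ s → Transversal heavy
  heavy-transversal ∣heavy∣≡s e e-edge with disjoint-or-meets e heavy
  ... | inj₂ meets = meets
  ... | inj₁ e∩heavy=∅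
    with es , family , ∣es∣≡t ← extend-through-rich s heavy (e ∷ []) ∣heavy∣≡s heavy⇒rich
                                  (e-edge , (λ x _ → ⊥!≢true x) , tt)
                                  (subst (λ X → Disjoint X heavy) (sym (∪-identityʳ e)) e∩heavy=∅) refl
    = ⊥-elim (no-t-family es family ∣es∣≡t)

  link : Fin n → Subset n → ℕ
  link x Y = ⟦ not (Y ! x) ∧ isEdge (Y ∪ ⁅ x ⁆) ⟧

  link≤degree : ∀ x → sumSubsets n (link x) ≤ degree x
  link≤degree x = countSubsets-injection n _ _ (_∪ ⁅ x ⁆) add-x add-x-injective
    where
    add-x : ∀ Y → (not (Y ! x) ∧ isEdge (Y ∪ ⁅ x ⁆)) ≡ true → ((Y ∪ ⁅ x ⁆) ! x ∧ isEdge (Y ∪ ⁅ x ⁆)) ≡ true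
    add-x Y Y-ok = ∧-intro {(Y ∪ ⁅ x ⁆) ! x} (trans (!-∪ Y ⁅ x ⁆ x) (∨-introʳ _ (!-⁅x⁆ x)))
                     (proj₂ (∧-elim {not (Y ! x)} Y-ok))
    x∉ : ∀ Y → (not (Y ! x) ∧ isEdge (Y ∪ ⁅ x ⁆)) ≡ true → Y ! x ≡ false
    x∉ Y = not≡true⇒≡false ∘ proj₁ ∘ ∧-elim {not (Y ! x)}
    add-x-injective : ∀ X Y → (not (X ! x) ∧ isEdge (X ∪ ⁅ x ⁆)) ≡ true → (not (Y ! x) ∧ isEdge (Y ∪ ⁅ x ⁆)) ≡ true →
      X ∪ ⁅ x ⁆ ≡ Y ∪ ⁅ x ⁆ → X ≡ Y
    add-x-injective X Y X-ok Y-ok X+x≡Y+x = subset-ext X Y pointwise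
      where
      pointwise : ∀ i → X ! i ≡ Y ! i
      pointwise i with i Finₚ.≟ x
      ... | yes refl = trans (x∉ X X-ok) (sym (x∉ Y Y-ok))
      ... | no i≢x = trans (sym (!-add X i≢x)) (trans (cong (_! i) X+x≡Y+x) (!-add Y i≢x))

  module FewHeavy (es : List (Subset n)) (family : Family es) (∣es∣<t : length es < t)
                  (W-transversal : Transversal (⋃ es)) where

    W : Subset n
    W = ⋃ es

    weightHeavy weightLight weightSmall weight : Subset n → ℕ
    weightHeavy T = coverWeight k ∣ T ∩ heavy ∣ ∣ T ─ heavy ∣
    weightLight T = sumFin n (λ x → ⟦ (W ─ heavy) ! x ⟧ * link x (T ─ W))
    weightSmall T = ⟦ ∣ T ─ W ∣ ≤ᵇ d ⟧
    weight T = weightHeavy T + (weightLight T + weightSmall T)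

    clique-weight≥1 : ∀ T → T ∈ˡ L → 1 ≤ weight T
    clique-weight≥1 T T∈L with ∣ T ─ W ∣ ≤? d
    ... | yes small = ≤-trans (≤-reflexive (cong ⟦_⟧ (sym (≤ᵇ-true small))))
                        (≤-trans (m≤n+m _ (weightLight T)) (m≤n+m _ (weightHeavy T)))
    ... | no ¬small with disjoint-or-meets T (W ─ heavy)
    ...   | inj₂ (x , x∈T , x∈W─heavy) =
      ≤-trans (≤-reflexive (sym light-term≡1))
        (≤-trans (sumFin-≥ n _ x) (≤-trans (m≤m+n (weightLight T) _) (m≤n+m _ (weightHeavy T))))
      where
      x∈W : W ! x ≡ true
      x∈W = ─⊆ᵇ W heavy x x∈W─heavy
      x∉T─W : (T ─ W) ! x ≡ false
      x∉T─W = trans (!-─ T W x) (cong₂ (λ a b → a ∧ not b) x∈T x∈W)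
      ∣T─W∣≡1+d : ∣ T ─ W ∣ ≡ suc d
      ∣T─W∣≡1+d = ≤-antisym (≤-pred (∣T─X∣<k W T W-transversal (proj₂ (clique-isEdges T T∈L)))) (≰⇒> ¬small)
      T─W+x⊆T : ((T ─ W) ∪ ⁅ x ⁆) ⊆ᵇ T
      T─W+x⊆T i i∈ with ∨-elim (trans (sym (!-∪ (T ─ W) ⁅ x ⁆ i)) i∈)
      ... | inj₁ i∈T─W = ─⊆ᵇ T W i i∈T─W
      ... | inj₂ i∈⁅x⁆ = subst (λ j → T ! j ≡ true) (sym (x∈⁅y⁆⇒x≡y x (!⇒∈ i∈⁅x⁆))) x∈T
      light-term≡1 : ⟦ (W ─ heavy) ! x ⟧ * link x (T ─ W) ≡ 1
      light-term≡1 = cong₂ (λ a b → ⟦ a ⟧ * ⟦ b ⟧) x∈W─heavy (∧-intro {not ((T ─ W) ! x)} (cong not x∉T─W)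
        (proj₂ (clique-isEdges T T∈L) _ T─W+x⊆T (trans (∣Y∪⁅x⁆∣≡1+∣Y∣ (T ─ W) x x∉T─W) (cong suc ∣T─W∣≡1+d))))
    ...   | inj₁ T∩light=∅ = ≤-trans (≤-reflexive (sym (coverWeight-of-clique heavy T T∈L ∣T─heavy∣<k))) (m≤m+n _ _)
      where
      T─heavy⊆T─W : (T ─ heavy) ⊆ᵇ (T ─ W)
      T─heavy⊆T─W i i∈ with W ! i in i∈W
      ... | true = ⊥-elim (T∩light=∅ i (─⊆ᵇ T heavy i i∈)
                     (trans (!-─ W heavy i) (cong₂ (λ a b → a ∧ not b) i∈W (─⇒∉ T heavy i i∈))))
      ... | false = trans (!-─ T W i) (cong₂ (λ a b → a ∧ not b) (─⊆ᵇ T heavy i i∈) i∈W)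
      ∣T─heavy∣<k : ∣ T ─ heavy ∣ < k
      ∣T─heavy∣<k = ≤-<-trans (⊆ᵇ⇒∣∣≤ (T ─ heavy) (T ─ W) T─heavy⊆T─W)
                              (∣T─X∣<k W T W-transversal (proj₂ (clique-isEdges T T∈L)))

    sum-weightLight : sumSubsets n weightLight ≤ ∣ W ∣ * (2 ^ ∣ W ∣ * threshold)
    sum-weightLight = begin
        sumSubsets n weightLight
      ≡⟨ sumSubsets-sumFin n n (λ x T → ⟦ (W ─ heavy) ! x ⟧ * link x (T ─ W)) ⟩
        sumFin n (λ x → sumSubsets n (λ T → ⟦ (W ─ heavy) ! x ⟧ * link x (T ─ W)))
      ≤⟨ sumFin-mono-≤ n per-vertex ⟩
        sumFin n (λ x → ⟦ W ! x ⟧ * (2 ^ ∣ W ∣ * threshold))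
      ≡⟨ sumFin-size W _ ⟩
        ∣ W ∣ * (2 ^ ∣ W ∣ * threshold)
      ∎
      where
      open ≤-Reasoning
      per-vertex : ∀ x →
        sumSubsets n (λ T → ⟦ (W ─ heavy) ! x ⟧ * link x (T ─ W)) ≤ ⟦ W ! x ⟧ * (2 ^ ∣ W ∣ * threshold)
      per-vertex x with (W ─ heavy) ! x in x∈W─heavy
      ... | false = ≤-trans (≤-reflexive (sumSubsets-* n 0 (λ T → link x (T ─ W)))) z≤n
      ... | true = begin
          sumSubsets n (λ T → 1 * link x (T ─ W))
        ≡⟨ sumSubsets-* n 1 _ ⟩
          1 * sumSubsets n (λ T → link x (T ─ W))
        ≤⟨ *-monoʳ-≤ 1 (sumSubsets-─ n W (link x)) ⟩
          1 * (2 ^ ∣ W ∣ * sumSubsets n (link x))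
        ≤⟨ *-monoʳ-≤ 1 (*-monoʳ-≤ (2 ^ ∣ W ∣) (≤-trans (link≤degree x) (light⇒degree≤ x x-light))) ⟩
          1 * (2 ^ ∣ W ∣ * threshold)
        ≡⟨ cong (λ b → ⟦ b ⟧ * (2 ^ ∣ W ∣ * threshold)) (sym (─⊆ᵇ W heavy x x∈W─heavy)) ⟩
          ⟦ W ! x ⟧ * (2 ^ ∣ W ∣ * threshold)
        ∎
        where
        x-light : heavy ! x ≡ false
        x-light = ─⇒∉ W heavy x x∈W─heavy

    sum-weightSmall : sumSubsets n weightSmall ≤ 2 ^ ∣ W ∣ * u
    sum-weightSmall =
      ≤-trans (sumSubsets-─ n W (λ Y → ⟦ ∣ Y ∣ ≤ᵇ d ⟧)) (*-monoʳ-≤ (2 ^ ∣ W ∣) (small-subsets-bound n d))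

    ∣W∣≤k*s : ∣ W ∣ ≤ k * s
    ∣W∣≤k*s = ≤-trans (∣⋃∣≤k*length es family) (*-monoʳ-≤ k (≤-pred ∣es∣<t))

    error≤ : ∣ W ∣ * (2 ^ ∣ W ∣ * threshold) + 2 ^ ∣ W ∣ * u ≤ errorConstant d s * u
    error≤ = ≤-trans (+-mono-≤ (*-mono-≤ ∣W∣≤k*s (*-monoˡ-≤ threshold (^-monoʳ-≤ 2 ∣W∣≤k*s)))
                               (*-monoˡ-≤ u (^-monoʳ-≤ 2 ∣W∣≤k*s)))
               (≤-reflexive (regroup (k * s) (2 ^ (k * s)) (k * t + t) u))
      where
      regroup : ∀ a b c v → a * (b * (c * v)) + b * v ≡ (a * (b * c) + b) * v
      regroup = solve-∀

    bound : ∣ heavy ∣ < s → s ≤ n → errorConstant d s * u ≤ (n ∸ s) C suc d → length L ≤ coverCount k s (n ∸ s)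
    bound ∣heavy∣<s s≤n large = begin
        length L
      ≤⟨ length≤sumSubsets n L weight L-unique clique-weight≥1 ⟩
        sumSubsets n weight
      ≡⟨ trans (sumSubsets-+ n weightHeavy _)
               (cong (sumSubsets n weightHeavy +_) (sumSubsets-+ n weightLight weightSmall)) ⟩
        sumSubsets n weightHeavy + (sumSubsets n weightLight + sumSubsets n weightSmall)
      ≤⟨ +-monoʳ-≤ (sumSubsets n weightHeavy) (≤-trans (+-mono-≤ sum-weightLight sum-weightSmall) error≤) ⟩
        sumSubsets n weightHeavy + errorConstant d s * u
      ≤⟨ +-monoʳ-≤ (sumSubsets n weightHeavy) large ⟩
        sumSubsets n weightHeavy + (n ∸ s) C suc d
      ≡⟨ cong (_+ (n ∸ s) C suc d) (sumSubsets-coverWeight≡coverCount n k heavy) ⟩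
        coverCount k ∣ heavy ∣ (n ∸ ∣ heavy ∣) + (n ∸ s) C suc d
      ≤⟨ coverCount-gap (s≤s z≤n) ∣heavy∣<s s≤n ⟩
        coverCount k s (n ∸ s)
      ∎
      where open ≤-Reasoning

  upper : s ≤ n → errorConstant d s * u ≤ (n ∸ s) C suc d → length L ≤ exValue k t n
  upper s≤n large = subst (length L ≤_) (sym (exValue≡coverCount k s n)) (by-heavy-count (<-cmp ∣ heavy ∣ s))
    where
    by-heavy-count : Tri (∣ heavy ∣ < s) (∣ heavy ∣ ≡ s) (s < ∣ heavy ∣) → length L ≤ coverCount k s (n ∸ s)
    by-heavy-count (tri> _ _ s<∣heavy∣) = ⊥-elim (too-many-heavy s<∣heavy∣)
    by-heavy-count (tri≈ _ ∣heavy∣≡s _) =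
      subst (λ b → length L ≤ coverCount k b (n ∸ b)) ∣heavy∣≡s
            (transversal-bound heavy (heavy-transversal ∣heavy∣≡s))
    by-heavy-count (tri< ∣heavy∣<s _ _) with maximal-family t [] tt refl
    ... | inj₁ (es , family , ∣es∣≡t) = ⊥-elim (no-t-family es family ∣es∣≡t)
    ... | inj₂ (es , family , ∣es∣<t , W-transversal) =
      FewHeavy.bound es family ∣es∣<t W-transversal ∣heavy∣<s s≤n large

-- Lower bound

module LowerBound (d s n : ℕ) (s≤n : s ≤ n) where

  k t : ℕ
  k = suc (suc d)
  t = suc s

  s-subset : Σ (Subset n) λ S → S ⊆ᵇ ⊤ × ∣ S ∣ ≡ s
  s-subset = subset-of-size s ⊤ (subst (s ≤_) (sym (∣⊤∣≡n n)) s≤n)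

  A : Subset n
  A = proj₁ s-subset

  ∣A∣≡s : ∣ A ∣ ≡ s
  ∣A∣≡s = proj₂ (proj₂ s-subset)

  isStarEdge : Subset n → Bool
  isStarEdge e = (∣ e ∣ ≡ᵇ k) ∧ not (disjointᵇ e A)

  star : Hypergraph n
  star = record { Edge = λ e → isStarEdge e ≡ true }

  star-uniform : Uniform k star
  star-uniform e e-edge = ≡ᵇ⇒≡ ∣ e ∣ k (Equivalence.from T-≡ (proj₁ (∧-elim {∣ e ∣ ≡ᵇ k} e-edge)))

  star-edge-meets-A : ∀ e → isStarEdge e ≡ true → Meets e A
  star-edge-meets-A e e-edge with disjoint-or-meets e A
  ... | inj₂ meets = meets
  ... | inj₁ e∩A=∅ = ⊥-elim (false≢true (trans (sym (cong not (disjointᵇ-complete e A e∩A=∅)))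
                                                (proj₂ (∧-elim {∣ e ∣ ≡ᵇ k} e-edge))))

  star-M-free : ¬ Contains star (Matching t k)
  star-M-free copy = <⇒≱ (≤-reflexive (cong suc ∣A∣≡s)) (matching⇒transversal-size star A star-edge-meets-A copy)

  isClique : Subset n → Bool
  isClique T = (∣ T ─ A ∣ <ᵇ k) ∧ (k ≤ᵇ ∣ T ∩ A ∣ + ∣ T ─ A ∣)

  isClique⇒bigClique : ∀ T → isClique T ≡ true → IsBigClique k star T
  isClique⇒bigClique T T-ok with ∣T─A∣<k , k≤∣T∣ ← ∧-elim {∣ T ─ A ∣ <ᵇ k} T-ok =
    everyKSubset⇒bigClique star T
      (≤-trans (≤ᵇ⇒≤ k _ (Equivalence.from T-≡ k≤∣T∣)) (≤-reflexive (sym (∣T∣≡∣T∩B∣+∣T─B∣ T A))))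
      (λ S S⊆T ∣S∣≡k → ∧-intro {∣ S ∣ ≡ᵇ k} (≡ᵇ-true ∣S∣≡k) (meets-A S S⊆T ∣S∣≡k))
    where
    meets-A : ∀ S → S ⊆ᵇ T → ∣ S ∣ ≡ k → not (disjointᵇ S A) ≡ true
    meets-A S S⊆T ∣S∣≡k with disjointᵇ S A in S∩A=∅
    ... | false = refl
    ... | true = ⊥-elim (<⇒≱ (<ᵇ⇒< _ k (Equivalence.from T-≡ ∣T─A∣<k)) (begin
        k            ≡⟨ sym ∣S∣≡k ⟩
        ∣ S ∣        ≤⟨ ⊆ᵇ⇒∣∣≤ S (T ─ A) S⊆T─A ⟩
        ∣ T ─ A ∣    ∎))
      where
      open ≤-Reasoning
      S⊆T─A : S ⊆ᵇ (T ─ A)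
      S⊆T─A x x∈S with A ! x in x∈A
      ... | true = ⊥-elim (disjointᵇ-sound S A S∩A=∅ x x∈S x∈A)
      ... | false = trans (!-─ T A x) (cong₂ (λ a b → a ∧ not b) (S⊆T x x∈S) x∈A)

  bigClique⇒isClique : ∀ T → IsBigClique k star T → isClique T ≡ true
  bigClique⇒isClique T T-clique
    with k≤∣T∣ , T-closed ← bigClique⇒everyKSubset star (s≤s (s≤s z≤n)) star-uniform T T-clique =
    ∧-intro {∣ T ─ A ∣ <ᵇ k} (<ᵇ-true (∣T─X∣<k A T star-edge-meets-A T-closed))
            (≤ᵇ-true {k} (≤-trans k≤∣T∣ (≤-reflexive (∣T∣≡∣T∩B∣+∣T─B∣ T A))))

  clique-count : countSubsets n isClique ≡ exValue k t n
  clique-count = begin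
      countSubsets n isClique                        ≡⟨ sumSubsets-coverWeight≡coverCount n k A ⟩
      coverCount k ∣ A ∣ (n ∸ ∣ A ∣)                 ≡⟨ cong (λ b → coverCount k b (n ∸ b)) ∣A∣≡s ⟩
      coverCount k s (n ∸ s)                         ≡⟨ sym (exValue≡coverCount k s n) ⟩
      exValue k t n                                  ∎
    where open ≡-Reasoning

  extremal : Σ (Hypergraph n) λ G → Free k (Matching t k) G × CountIs (IsBigClique k G) (exValue k t n)
  extremal = star , (star-uniform , star-M-free) ,
    enumerate n isClique , enumerate-unique n isClique ,
    (λ T → mk⇔ (isClique⇒bigClique T ∘ enumerate-sound n isClique T)
               (enumerate-complete n isClique T ∘ bigClique⇒isClique T)) ,
    trans (enumerate-length n isClique) clique-count

proposition3p1 : (k t : ℕ) → 2 ≤ k → 1 ≤ t →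
    Σ ℕ λ n₀ → ∀ n → n₀ ≤ n → ExCliquePlusIs k n (Matching t k) (exValue k t n)
proposition3p1 (suc zero) _ (s≤s ()) _
proposition3p1 (suc (suc d)) (suc s) _ _
  with n₀ , s≤n₀ , large ← polynomial≤binomial (errorConstant d s) d s =
  n₀ , λ n n₀≤n → LowerBound.extremal d s n (≤-trans s≤n₀ n₀≤n) ,
    λ G (uniform , M-free) M (L , L-unique , L-cliques , ∣L∣≡M) →
      subst (_≤ exValue (suc (suc d)) (suc s) n) ∣L∣≡M
        (UpperBound.upper d s n G uniform M-free L L-unique L-cliques (≤-trans s≤n₀ n₀≤n) (large n n₀≤n))
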